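{- Define polynomials $\gamma_n(x,y)$ by $\gamma_1(x,y)=xy$ and $\gamma_{n+1}(x,y)=(4n+2)xy\gamma_n(x,y)+xy(1-2x)\frac{\partial}{\partial x}\gamma_n(x,y)+xy(1-4y)\frac{\partial}{\partial y}\gamma_n(x,y)$, and write $\gamma_n(x,y)=\sum_{i,j}\gamma_{n,i,j}x^iy^j$. Then for $n\ge1$, $$\gamma_{n,i,j}=\#\{\sigma\in\mathcal Q_n:\ \mathrm{des}(\sigma)=i,\ \mathrm{laplat}(\sigma)=j,\ \mathrm{desp}(\sigma)=0\}.$$
   Context: $\mathcal Q_n$ is the set of Stirling permutations of order $n$: permutations $\sigma=\sigma_1\cdots\sigma_{2n}$ of $\{1,1,2,2,\dots,n,n\}$ such that for each $i$, all entries between the two occurrences of $i$ are larger than $i$. Set $\sigma_0=\sigma_{2n+1}=0$. $\mathrm{des}(\sigma)=\#\{i:0\le i\le 2n,\ \sigma_i>\sigma_{i+1}\}$. An index $i\in[2n-1]$ is a left ascent-plateau if $\sigma_{i-1}<\sigma_i=\sigma_{i+1}$ and a descent-plateau if $\sigma_{i-1}>\sigma_i=\sigma_{i+1}$; $\mathrm{laplat}(\sigma)$ and $\mathrm{desp}(\sigma)$ count them. -}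

module Defs where

open import Data.Nat using (ℕ; zero; suc; _+_; _*_; _∸_; _≡ᵇ_; _<ᵇ_)
open import Data.Integer as ℤ using (ℤ; +_)
open import Data.Bool using (Bool; true; false; _∧_; _∨_; not; if_then_else_)
open import Data.List using (List; []; _∷_; _++_; [_]; map; concatMap; filter; length; upTo)
open import Relation.Nullary.Decidable using (does)
open import Data.Bool.Properties using (T?)

-- Bivariate polynomials over ℤ, represented by their coefficient
-- function: p i j = coefficient of x^i y^j.

Poly : Set
Poly = ℕ → ℕ → ℤ

_⊕_ : Poly → Poly → Poly
(p ⊕ q) i j = p i j ℤ.+ q i j

_⊛_ : ℤ → Poly → Poly
(c ⊛ p) i j = c ℤ.* p i j

mulX : Poly → Poly
mulX p zero    j = + 0
mulX p (suc i) j = p i j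

mulY : Poly → Poly
mulY p i zero    = + 0
mulY p i (suc j) = p i j

∂x : Poly → Poly
∂x p i j = + (suc i) ℤ.* p (suc i) j

∂y : Poly → Poly
∂y p i j = + (suc j) ℤ.* p i (suc j)

xy : Poly
xy (suc zero) (suc zero) = + 1
xy _          _          = + 0

oneMinus2x : Poly → Poly
oneMinus2x p = p ⊕ ((ℤ.- (+ 2)) ⊛ mulX p)

oneMinus4y : Poly → Poly
oneMinus4y p = p ⊕ ((ℤ.- (+ 4)) ⊛ mulY p)

step : ℕ → Poly → Poly
step n g =
  ((+ (4 * n + 2)) ⊛ mulX (mulY g))
  ⊕ (mulX (mulY (oneMinus2x (∂x g))) ⊕ mulX (mulY (oneMinus4y (∂y g))))

-- γ n for n ≥ 1 (γ 0 is an unused dummy value 0); γ 1 = xy.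
γ : ℕ → Poly
γ zero          = λ _ _ → + 0
γ (suc zero)    = xy
γ (suc (suc n)) = step (suc n) (γ (suc n))

-- σ at position k (0-based), 0 if out of range
at : List ℕ → ℕ → ℕ
at []       _       = 0
at (x ∷ xs) zero    = x
at (x ∷ xs) (suc k) = at xs k

words : ℕ → ℕ → List (List ℕ)
words zero    n = [ [] ]
words (suc m) n = concatMap (λ w → map (λ a → a ∷ w) (map suc (upTo n))) (words m n)

all : {A : Set} → (A → Bool) → List A → Bool
all P []       = true
all P (x ∷ xs) = P x ∧ all P xs

count : ℕ → List ℕ → ℕ
count a []       = 0
count a (x ∷ xs) = (if a ≡ᵇ x then 1 else 0) + count a xs

countRange : ℕ → ℕ → (ℕ → Bool) → ℕ
countRange lo hi P = length (filter (λ k → T? (P k)) (map (λ t → lo + t) (upTo (hi ∸ lo))))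

_⇒ᵇ_ : Bool → Bool → Bool
a ⇒ᵇ b = not a ∨ b

isStirling : ℕ → List ℕ → Bool
isStirling n σ =
  (length σ ≡ᵇ 2 * n)
  ∧ all (λ a → (1 <ᵇ suc a) ∧ (a <ᵇ suc n)) σ
  ∧ all (λ k → count k σ ≡ᵇ 2) (map suc (upTo n))
  ∧ all (λ r → all (λ q → all (λ p →
        (at σ p ≡ᵇ at σ r) ⇒ᵇ (at σ p <ᵇ at σ q)) (upTo q)) (upTo r)) (upTo (length σ))

-- padded word τ = σ_0 σ_1 … σ_{2n} σ_{2n+1} with σ_0 = σ_{2n+1} = 0,
-- so that τ at index i is σ_i (1-based indexing of σ).
pad : List ℕ → List ℕ
pad σ = 0 ∷ σ ++ [ 0 ]

des : List ℕ → ℕ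
des σ = countRange 0 (suc (length σ)) (λ i → at (pad σ) (suc i) <ᵇ at (pad σ) i)

laplat : List ℕ → ℕ
laplat σ = countRange 1 (length σ)
  (λ i → (at (pad σ) (i ∸ 1) <ᵇ at (pad σ) i) ∧ (at (pad σ) i ≡ᵇ at (pad σ) (suc i)))

desp : List ℕ → ℕ
desp σ = countRange 1 (length σ)
  (λ i → (at (pad σ) i <ᵇ at (pad σ) (i ∸ 1)) ∧ (at (pad σ) i ≡ᵇ at (pad σ) (suc i)))

𝒬 : ℕ → List (List ℕ)
𝒬 n = filter (λ σ → T? (isStirling n σ)) (words (2 * n) n)

stirCount : ℕ → ℕ → ℕ → ℕ
stirCount n i j = length (filter (λ σ → T? ((des σ ≡ᵇ i) ∧ (laplat σ ≡ᵇ j) ∧ (desp σ ≡ᵇ 0))) (𝒬 n))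

-- Every σ ∈ 𝒬 (n+1) arises exactly once by inserting (n+1)(n+1) into one of the 2n+1 gaps of
-- some τ ∈ 𝒬 n (the gaps of the padded word 0 τ 0). The effect of the insertion on
-- (des, laplat, desp) depends only on the type of the gap: inside a descent, inside a left
-- ascent-plateau, inside a descent-plateau, just before an ascent-plateau, or any other ascent;
-- and τ has des, laplat, desp, laplat and 2n+1-des-2·laplat-desp gaps of these types. This gives
-- a recurrence for the number T_n(d,l,p) of σ ∈ 𝒬 n with statistics (d,l,p), and its solution
-- T_n(d,l,p) = γ_n(d,l) · C(2n+1-d-2l, p) is checked against the recurrence of γ by induction,
-- together with γ_n(d,l) = 0 for d+2l > 2n+1. The theorem is the case p = 0.

module Submission where

open import Defs
open import Data.Bool using (Bool; true; false; T; _∧_; if_then_else_)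
open import Data.Bool.Properties using (T?; T-∧; ∧-zeroʳ; ∧-identityʳ)
open import Data.Empty using (⊥-elim)
open import Data.List using (List; []; _∷_; _++_; map; concatMap; filter; length; upTo; applyUpTo)
open import Data.Nat.ListAction using (sum)
open import Data.List.Properties using (length-++; map-∘; map-upTo; upTo-∷ʳ; ∷-injectiveˡ; ∷-injectiveʳ)
open import Data.List.Membership.Propositional using (_∈_; _∉_; find)
open import Data.List.Membership.Propositional.Properties
open import Data.List.Relation.Unary.Any as Any using (here; there)
open import Data.List.Relation.Unary.All as All using (All; []; _∷_)
import Data.List.Relation.Unary.All.Properties as All
open import Data.List.Relation.Unary.AllPairs as AllPairs using (AllPairs; []; _∷_)
import Data.List.Relation.Unary.AllPairs.Properties as AllPairs
open import Data.List.Relation.Unary.Unique.Propositional using (Unique)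
import Data.List.Relation.Unary.Unique.Propositional.Properties as Unique
open import Data.List.Relation.Binary.BagAndSetEquality using (∼bag⇒↭)
open import Data.List.Membership.Propositional.Properties.WithK using (unique∧set⇒bag)
import Data.List.Relation.Binary.Permutation.Propositional.Properties as Perm
open import Data.Nat using (ℕ; zero; suc; _≤_; _<_; z≤n; s≤s; _≡ᵇ_; _<ᵇ_)
open import Data.Product using (∃; _×_; _,_; proj₁; proj₂)
open import Data.Unit using (⊤; tt)
open import Data.Maybe using (Maybe; just; nothing; maybe)
open import Function using (_∘_)
open import Function.Bundles using (mk⇔; Equivalence)
open import Relation.Nullary using (¬_; yes; no)
open import Relation.Binary.PropositionalEquality
open import Relation.Binary using (tri<; tri≈; tri>)
open import Data.List.Relation.Binary.Pointwise using (Pointwise; []; _∷_)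

module StatisticsRecurrence where

  open import Data.Nat using (_+_; _*_; _∸_; _<?_)
  open import Data.Nat.Properties
  open import Data.Nat.Tactic.RingSolver using (solve-∀)
  open import Algebra.Properties.CommutativeSemigroup +-commutativeSemigroup using (interchange)

  boolToℕ : Bool → ℕ
  boolToℕ true  = 1
  boolToℕ false = 0

  countᵇ : {A : Set} → (A → Bool) → List A → ℕ
  countᵇ P xs = length (filter (T? ∘ P) xs)

  countᵇ-∷ : {A : Set} (P : A → Bool) (x : A) (xs : List A) → countᵇ P (x ∷ xs) ≡ boolToℕ (P x) + countᵇ P xs
  countᵇ-∷ P x xs with P x
  ... | true  = refl
  ... | false = refl

  module _ {A : Set} (P : A → Bool) where

    countᵇ-++ : ∀ xs ys → countᵇ P (xs ++ ys) ≡ countᵇ P xs + countᵇ P ys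
    countᵇ-++ []       ys = refl
    countᵇ-++ (x ∷ xs) ys = begin
      countᵇ P (x ∷ xs ++ ys)                       ≡⟨ countᵇ-∷ P x (xs ++ ys) ⟩
      boolToℕ (P x) + countᵇ P (xs ++ ys)           ≡⟨ cong (boolToℕ (P x) +_) (countᵇ-++ xs ys) ⟩
      boolToℕ (P x) + (countᵇ P xs + countᵇ P ys)   ≡⟨ +-assoc (boolToℕ (P x)) _ _ ⟨
      boolToℕ (P x) + countᵇ P xs + countᵇ P ys     ≡⟨ cong (_+ countᵇ P ys) (countᵇ-∷ P x xs) ⟨
      countᵇ P (x ∷ xs) + countᵇ P ys               ∎
      where open ≡-Reasoning

    countᵇ-concatMap : {B : Set} (f : B → List A) (xs : List B) →
                       countᵇ P (concatMap f xs) ≡ sum (map (countᵇ P ∘ f) xs)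
    countᵇ-concatMap f []       = refl
    countᵇ-concatMap f (x ∷ xs) =
      trans (countᵇ-++ (f x) (concatMap f xs)) (cong (countᵇ P (f x) +_) (countᵇ-concatMap f xs))

    countᵇ-cong-∈ : ∀ (Q : A → Bool) xs → (∀ {x} → x ∈ xs → P x ≡ Q x) → countᵇ P xs ≡ countᵇ Q xs
    countᵇ-cong-∈ Q []       _  = refl
    countᵇ-cong-∈ Q (x ∷ xs) eq = begin
      countᵇ P (x ∷ xs)                ≡⟨ countᵇ-∷ P x xs ⟩
      boolToℕ (P x) + countᵇ P xs      ≡⟨ cong₂ _+_ (cong boolToℕ (eq (here refl))) (countᵇ-cong-∈ Q xs (eq ∘ there)) ⟩
      boolToℕ (Q x) + countᵇ Q xs      ≡⟨ countᵇ-∷ Q x xs ⟨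
      countᵇ Q (x ∷ xs)                ∎
      where open ≡-Reasoning

    countᵇ-unique-sameElements : ∀ {xs ys} → Unique xs → Unique ys →
      (∀ {x} → x ∈ xs → x ∈ ys) → (∀ {x} → x ∈ ys → x ∈ xs) → countᵇ P xs ≡ countᵇ P ys
    countᵇ-unique-sameElements uxs uys xs⊆ys ys⊆xs =
      Perm.↭-length (Perm.filter-↭ (T? ∘ P) (∼bag⇒↭ (unique∧set⇒bag uxs uys (mk⇔ xs⊆ys ys⊆xs))))

  countᵇ-map : {A B : Set} (P : B → Bool) (f : A → B) (xs : List A) → countᵇ P (map f xs) ≡ countᵇ (P ∘ f) xs
  countᵇ-map P f []       = refl
  countᵇ-map P f (x ∷ xs) =
    trans (countᵇ-∷ P (f x) (map f xs)) (trans (cong (boolToℕ (P (f x)) +_) (countᵇ-map P f xs))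
          (sym (countᵇ-∷ (P ∘ f) x xs)))

  module _ {A : Set} where

    sum-map-cong-∈ : (f g : A → ℕ) (xs : List A) → (∀ {x} → x ∈ xs → f x ≡ g x) → sum (map f xs) ≡ sum (map g xs)
    sum-map-cong-∈ f g []       _  = refl
    sum-map-cong-∈ f g (x ∷ xs) eq = cong₂ _+_ (eq (here refl)) (sum-map-cong-∈ f g xs (eq ∘ there))

    sum-map-+ : (f g : A → ℕ) (xs : List A) → sum (map (λ x → f x + g x) xs) ≡ sum (map f xs) + sum (map g xs)
    sum-map-+ f g []       = refl
    sum-map-+ f g (x ∷ xs) =
      trans (cong (f x + g x +_) (sum-map-+ f g xs)) (interchange (f x) (g x) (sum (map f xs)) (sum (map g xs)))

    sum-map-zero : (f : A → ℕ) (xs : List A) → (∀ x → f x ≡ 0) → sum (map f xs) ≡ 0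
    sum-map-zero f []       _  = refl
    sum-map-zero f (x ∷ xs) f0 = cong₂ _+_ (f0 x) (sum-map-zero f xs f0)

  sum-map-swap : {A B : Set} (h : A → B → ℕ) (xs : List A) (ys : List B) →
    sum (map (λ x → sum (map (h x) ys)) xs) ≡ sum (map (λ y → sum (map (λ x → h x y) xs)) ys)
  sum-map-swap h []       ys = sym (sum-map-zero _ ys (λ _ → refl))
  sum-map-swap h (x ∷ xs) ys =
    trans (cong (sum (map (h x) ys) +_) (sum-map-swap h xs ys))
          (sym (sum-map-+ (h x) (λ y → sum (map (λ x → h x y) xs)) ys))

  AllPairs-map-All : {A : Set} {R S : A → A → Set} {Q : A → Set} →
    (∀ {x y} → Q x → Q y → R x y → S x y) → ∀ {xs} → All Q xs → AllPairs R xs → AllPairs S xs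
  AllPairs-map-All f []       []       = []
  AllPairs-map-All f (q ∷ qs) (r ∷ rs) = All.zipWith (λ (r′ , q′) → f q q′ r′) (r , qs) ∷ AllPairs-map-All f qs rs

  T-∧⁻ : ∀ {a b} → T (a ∧ b) → T a × T b
  T-∧⁻ = Equivalence.to T-∧

  T-∧⁺ : ∀ {a b} → T a → T b → T (a ∧ b)
  T-∧⁺ p q = Equivalence.from T-∧ (p , q)

  T-all⁻ : {A : Set} (P : A → Bool) (xs : List A) → T (all P xs) → All (T ∘ P) xs
  T-all⁻ P []       _ = []
  T-all⁻ P (x ∷ xs) t = let (p , ps) = T-∧⁻ {P x} t in p ∷ T-all⁻ P xs ps

  T-all⁺ : {A : Set} (P : A → Bool) (xs : List A) → All (T ∘ P) xs → T (all P xs)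
  T-all⁺ P []       []       = tt
  T-all⁺ P (x ∷ xs) (p ∷ ps) = T-∧⁺ {P x} p (T-all⁺ P xs ps)

  T-all-upTo⁻ : (P : ℕ → Bool) (n : ℕ) → T (all P (upTo n)) → ∀ k → k < n → T (P k)
  T-all-upTo⁻ P n t k k<n = All.lookup (T-all⁻ P (upTo n) t) (∈-upTo⁺ k<n)

  T-all-upTo⁺ : (P : ℕ → Bool) (n : ℕ) → (∀ k → k < n → T (P k)) → T (all P (upTo n))
  T-all-upTo⁺ P n f = T-all⁺ P (upTo n) (All.tabulate (f _ ∘ ∈-upTo⁻))

  at-∈ : ∀ (xs : List ℕ) {r} → r < length xs → at xs r ∈ xs
  at-∈ (x ∷ xs) {zero}  _         = here refl
  at-∈ (x ∷ xs) {suc r} (s≤s r<) = there (at-∈ xs r<)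

  ∈⇒at : ∀ {x} (xs : List ℕ) → x ∈ xs → ∃ λ r → r < length xs × at xs r ≡ x
  ∈⇒at (y ∷ xs) (here refl) = zero , s≤s z≤n , refl
  ∈⇒at (y ∷ xs) (there p)   = let (r , r< , eq) = ∈⇒at xs p in suc r , s≤s r< , eq

  -- The nesting condition of isStirling, by recursion on the word: every entry of ys
  -- that precedes an occurrence of x exceeds x.
  LargerBefore : ℕ → List ℕ → Set
  LargerBefore x []       = ⊤
  LargerBefore x (y ∷ ys) = (x ∈ ys → x < y) × LargerBefore x ys

  Nested : List ℕ → Set
  Nested []       = ⊤
  Nested (x ∷ xs) = LargerBefore x xs × Nested xs

  NestedAt : List ℕ → Set
  NestedAt σ = ∀ {p q r} → p < q → q < r → r < length σ → at σ p ≡ at σ r → at σ p < at σ q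

  LargerBeforeAt : ℕ → List ℕ → Set
  LargerBeforeAt x ys = ∀ {q r} → q < r → r < length ys → at ys r ≡ x → x < at ys q

  LargerBefore⇒At : ∀ x ys → LargerBefore x ys → LargerBeforeAt x ys
  LargerBefore⇒At x (y ∷ ys) (h , hs) {zero}  {suc r} _         (s≤s r<) eq = h (subst (_∈ ys) eq (at-∈ ys r<))
  LargerBefore⇒At x (y ∷ ys) (h , hs) {suc q} {suc r} (s≤s q<r) (s≤s r<) eq = LargerBefore⇒At x ys hs q<r r< eq

  At⇒LargerBefore : ∀ x ys → LargerBeforeAt x ys → LargerBefore x ys
  At⇒LargerBefore x []       h = tt
  At⇒LargerBefore x (y ∷ ys) h =
    (λ x∈ys → let (r , r< , eq) = ∈⇒at ys x∈ys in h (s≤s z≤n) (s≤s r<) eq) ,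
    At⇒LargerBefore x ys (λ q<r r< → h (s≤s q<r) (s≤s r<))

  Nested⇒At : ∀ σ → Nested σ → NestedAt σ
  Nested⇒At (x ∷ xs) (h , t) {zero}  {suc q} {suc r} _         (s≤s q<r) (s≤s r<) eq = LargerBefore⇒At x xs h q<r r< (sym eq)
  Nested⇒At (x ∷ xs) (h , t) {suc p} {suc q} {suc r} (s≤s p<q) (s≤s q<r) (s≤s r<) eq = Nested⇒At xs t p<q q<r r< eq

  At⇒Nested : ∀ σ → NestedAt σ → Nested σ
  At⇒Nested []       t = tt
  At⇒Nested (x ∷ xs) t =
    At⇒LargerBefore x xs (λ q<r r< eq → t (s≤s z≤n) (s≤s q<r) (s≤s r<) (sym eq)) ,
    At⇒Nested xs (λ p<q q<r r< → t (s≤s p<q) (s≤s q<r) (s≤s r<))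

  nestedᵇ : List ℕ → Bool
  nestedᵇ σ = all (λ r → all (λ q → all (λ p →
                (at σ p ≡ᵇ at σ r) ⇒ᵇ (at σ p <ᵇ at σ q)) (upTo q)) (upTo r)) (upTo (length σ))

  T-⇒ᵇ⁻ : ∀ {a b} → T (a ⇒ᵇ b) → T a → T b
  T-⇒ᵇ⁻ {true} t _ = t

  T-⇒ᵇ⁺ : ∀ {a b} → (T a → T b) → T (a ⇒ᵇ b)
  T-⇒ᵇ⁺ {false} _ = tt
  T-⇒ᵇ⁺ {true}  f = f tt

  T-nestedᵇ⇒Nested : ∀ σ → T (nestedᵇ σ) → Nested σ
  T-nestedᵇ⇒Nested σ t = At⇒Nested σ λ {p} {q} {r} p<q q<r r< eq →
    <ᵇ⇒< _ _ (T-⇒ᵇ⁻ (T-all-upTo⁻ _ q (T-all-upTo⁻ _ r (T-all-upTo⁻ _ (length σ) t r r<) q q<r) p p<q)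
                    (≡⇒≡ᵇ _ _ eq))

  Nested⇒T-nestedᵇ : ∀ σ → Nested σ → T (nestedᵇ σ)
  Nested⇒T-nestedᵇ σ nest = T-all-upTo⁺ _ _ λ r r< → T-all-upTo⁺ _ _ λ q q<r → T-all-upTo⁺ _ _ λ p p<q →
    T-⇒ᵇ⁺ (λ eq → <⇒<ᵇ (Nested⇒At σ nest p<q q<r r< (≡ᵇ⇒≡ _ _ eq)))

  record Stirling (n : ℕ) (σ : List ℕ) : Set where
    constructor mkStirling
    field
      length≡ : length σ ≡ 2 * n
      bounded : All (λ a → 1 ≤ a × a ≤ n) σ
      twice   : ∀ k → k < n → count (suc k) σ ≡ 2
      nested  : Nested σ
  open Stirling

  T-isStirling⇒Stirling : ∀ n σ → T (isStirling n σ) → Stirling n σ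
  T-isStirling⇒Stirling n σ t =
    let (t-len , t′)         = T-∧⁻ {length σ ≡ᵇ 2 * n} t
        (t-bounded , t″)     = T-∧⁻ {all (λ a → (1 <ᵇ suc a) ∧ (a <ᵇ suc n)) σ} t′
        (t-twice , t-nested) = T-∧⁻ {all (λ k → count k σ ≡ᵇ 2) (map suc (upTo n))} t″
        twiceᵇ               = All.map⁻ (T-all⁻ _ (map suc (upTo n)) t-twice)
    in mkStirling (≡ᵇ⇒≡ _ _ t-len)
         (All.map (λ t-a → let (p , q) = T-∧⁻ t-a in ≤-pred (<ᵇ⇒< _ _ p) , ≤-pred (<ᵇ⇒< _ _ q))
                  (T-all⁻ _ σ t-bounded))
         (λ k k<n → ≡ᵇ⇒≡ _ _ (All.lookup twiceᵇ (∈-upTo⁺ k<n)))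
         (T-nestedᵇ⇒Nested σ t-nested)

  Stirling⇒T-isStirling : ∀ n σ → Stirling n σ → T (isStirling n σ)
  Stirling⇒T-isStirling n σ (mkStirling len bnd tw nest) =
    T-∧⁺ {length σ ≡ᵇ 2 * n} (≡⇒≡ᵇ _ _ len)
    (T-∧⁺ {all (λ a → (1 <ᵇ suc a) ∧ (a <ᵇ suc n)) σ}
       (T-all⁺ _ σ (All.map (λ {a} (p , q) → T-∧⁺ {1 <ᵇ suc a} (<⇒<ᵇ (s≤s p)) (<⇒<ᵇ (s≤s q))) bnd))
    (T-∧⁺ {all (λ k → count k σ ≡ᵇ 2) (map suc (upTo n))}
       (T-all⁺ _ (map suc (upTo n)) (All.map⁺ (All.tabulate (λ k∈ → ≡⇒≡ᵇ _ _ (tw _ (∈-upTo⁻ k∈))))))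
       (Nested⇒T-nestedᵇ σ nest)))

  ∈-words : ∀ m n (w : List ℕ) → length w ≡ m → All (λ a → 1 ≤ a × a ≤ n) w → w ∈ words m n
  ∈-words zero    n []          refl []                        = here refl
  ∈-words (suc m) n (suc a ∷ w) refl ((s≤s _ , s≤s a≤n) ∷ bnd) =
    ∈-concatMap⁺ (λ w → map (λ a → a ∷ w) (map suc (upTo n)))
      (Any.map (λ { refl → ∈-map⁺ (λ a → a ∷ w) (∈-map⁺ suc (∈-upTo⁺ (s≤s a≤n))) }) (∈-words m n w refl bnd))

  extensions : ℕ → List ℕ → List (List ℕ)
  extensions n w = map (λ a → a ∷ w) (map suc (upTo n))

  words-unique : ∀ m n → Unique (words m n)
  words-unique zero    n = [] ∷ []
  words-unique (suc m) n = Unique.concat⁺ {xss = map (extensions n) (words m n)}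
    (All.map⁺ (All.tabulate λ _ → Unique.map⁺ (λ { refl → refl }) (Unique.map⁺ suc-injective (Unique.upTo⁺ n))))
    (AllPairs.map⁺ (AllPairs.map (λ w≢w′ {v} (p , q) → w≢w′ (∷-injectiveʳ (trans (sym (headed p)) (headed q))))
                                 (words-unique m n)))
    where
    headed : ∀ {w v} (p : v ∈ extensions n w) → v ≡ proj₁ (∈-map⁻ (λ a → a ∷ w) p) ∷ w
    headed {w} p = proj₂ (proj₂ (∈-map⁻ (λ a → a ∷ w) p))

  𝒬-unique : ∀ n → Unique (𝒬 n)
  𝒬-unique n = Unique.filter⁺ (T? ∘ isStirling n) (words-unique (2 * n) n)

  ∈𝒬⇒Stirling : ∀ {n σ} → σ ∈ 𝒬 n → Stirling n σ
  ∈𝒬⇒Stirling {n} {σ} p =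
    T-isStirling⇒Stirling n σ (proj₂ (∈-filter⁻ (T? ∘ isStirling n) {xs = words (2 * n) n} p))

  Stirling⇒∈𝒬 : ∀ {n σ} → Stirling n σ → σ ∈ 𝒬 n
  Stirling⇒∈𝒬 {n} {σ} s =
    ∈-filter⁺ (T? ∘ isStirling n) (∈-words (2 * n) n σ (length≡ s) (bounded s)) (Stirling⇒T-isStirling n σ s)

  ≡ᵇ-refl : ∀ a → (a ≡ᵇ a) ≡ true
  ≡ᵇ-refl zero    = refl
  ≡ᵇ-refl (suc a) = ≡ᵇ-refl a

  ≢⇒≡ᵇ≡false : ∀ {a b} → a ≢ b → (a ≡ᵇ b) ≡ false
  ≢⇒≡ᵇ≡false {a} {b} a≢b with a ≡ᵇ b in eq
  ... | false = refl
  ... | true  = ⊥-elim (a≢b (≡ᵇ⇒≡ a b (subst T (sym eq) tt)))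

  count-++ : ∀ a (xs ys : List ℕ) → count a (xs ++ ys) ≡ count a xs + count a ys
  count-++ a []       ys = refl
  count-++ a (x ∷ xs) ys = trans (cong (_ +_) (count-++ a xs ys)) (sym (+-assoc (if a ≡ᵇ x then 1 else 0) _ _))

  count-∉ : ∀ a (xs : List ℕ) → a ∉ xs → count a xs ≡ 0
  count-∉ a []       _    = refl
  count-∉ a (x ∷ xs) a∉xs rewrite ≢⇒≡ᵇ≡false (a∉xs ∘ here) = count-∉ a xs (a∉xs ∘ there)

  count>0⇒∈ : ∀ a (xs : List ℕ) → 0 < count a xs → a ∈ xs
  count>0⇒∈ a (x ∷ xs) pos with a ≟ x
  ... | yes refl = here refl
  ... | no  a≢x rewrite ≢⇒≡ᵇ≡false a≢x = there (count>0⇒∈ a xs pos)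

  ∈⇒count>0 : ∀ a (xs : List ℕ) → a ∈ xs → 0 < count a xs
  ∈⇒count>0 a (x ∷ xs) (here refl) rewrite ≡ᵇ-refl a = s≤s z≤n
  ∈⇒count>0 a (x ∷ xs) (there p)   = <-≤-trans (∈⇒count>0 a xs p) (m≤n+m _ (if a ≡ᵇ x then 1 else 0))

  insertions : ℕ → List ℕ → List (List ℕ)
  insertions m []       = (m ∷ m ∷ []) ∷ []
  insertions m (x ∷ xs) = (m ∷ m ∷ x ∷ xs) ∷ map (x ∷_) (insertions m xs)

  ∈-insertions⁺ : ∀ m (u v : List ℕ) → u ++ m ∷ m ∷ v ∈ insertions m (u ++ v)
  ∈-insertions⁺ m []      []      = here refl
  ∈-insertions⁺ m []      (x ∷ v) = here refl
  ∈-insertions⁺ m (x ∷ u) v       = there (∈-map⁺ (x ∷_) (∈-insertions⁺ m u v))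

  ∈-insertions⁻ : ∀ m (τ : List ℕ) {σ} → σ ∈ insertions m τ →
                  ∃ λ u → ∃ λ v → τ ≡ u ++ v × σ ≡ u ++ m ∷ m ∷ v
  ∈-insertions⁻ m []      (here refl) = [] , [] , refl , refl
  ∈-insertions⁻ m (x ∷ τ) (here refl) = [] , x ∷ τ , refl , refl
  ∈-insertions⁻ m (x ∷ τ) (there p)
    with _ , q , refl ← ∈-map⁻ (x ∷_) p
    with u , v , refl , refl ← ∈-insertions⁻ m τ q = x ∷ u , v , refl , refl

  removePair : ℕ → List ℕ → List ℕ
  removePair m []      = []
  removePair m (x ∷ xs) = if x ≡ᵇ m then drop1 xs else x ∷ removePair m xs
    where
    drop1 : List ℕ → List ℕ
    drop1 []       = []
    drop1 (_ ∷ ys) = ys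

  removePair-insertion : ∀ m (u v : List ℕ) → m ∉ u → removePair m (u ++ m ∷ m ∷ v) ≡ u ++ v
  removePair-insertion m []      v _    rewrite ≡ᵇ-refl m = refl
  removePair-insertion m (x ∷ u) v m∉u rewrite ≢⇒≡ᵇ≡false {x} {m} (m∉u ∘ here ∘ sym) =
    cong (x ∷_) (removePair-insertion m u v (m∉u ∘ there))

  removePair-∈-insertions : ∀ m τ {σ} → m ∉ τ → σ ∈ insertions m τ → removePair m σ ≡ τ
  removePair-∈-insertions m τ m∉τ p with u , v , refl , refl ← ∈-insertions⁻ m τ p =
    removePair-insertion m u v (m∉τ ∘ ∈-++⁺ˡ)

  insertions-unique : ∀ m τ → m ∉ τ → Unique (insertions m τ)
  insertions-unique m []      _    = [] ∷ []
  insertions-unique m (x ∷ τ) m∉xτ =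
    All.tabulate (λ p eq → m∉xτ (here (∷-injectiveˡ (trans eq (headed p))))) ∷
    Unique.map⁺ (λ { refl → refl }) (insertions-unique m τ (m∉xτ ∘ there))
    where
    headed : ∀ {σ} (p : σ ∈ map (x ∷_) (insertions m τ)) → σ ≡ x ∷ proj₁ (∈-map⁻ (x ∷_) p)
    headed p = proj₂ (proj₂ (∈-map⁻ (x ∷_) p))

  count-insertion : ∀ a m (u v : List ℕ) → count a (u ++ m ∷ m ∷ v) ≡ count a (m ∷ m ∷ u ++ v)
  count-insertion a m []      v = refl
  count-insertion a m (x ∷ u) v =
    trans (cong (_ +_) (count-insertion a m u v))
          (x+[y+[y+z]]≡y+[y+[x+z]] (if a ≡ᵇ x then 1 else 0) (if a ≡ᵇ m then 1 else 0) (count a (u ++ v)))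
    where
    x+[y+[y+z]]≡y+[y+[x+z]] : ∀ x y z → x + (y + (y + z)) ≡ y + (y + (x + z))
    x+[y+[y+z]]≡y+[y+[x+z]] = solve-∀

  length-insertion : ∀ m (u v : List ℕ) → length (u ++ m ∷ m ∷ v) ≡ 2 + length (u ++ v)
  length-insertion m []      v = refl
  length-insertion m (x ∷ u) v = cong suc (length-insertion m u v)

  module _ (m : ℕ) where

    ∈-insertion⁻ : ∀ {x} (u v : List ℕ) → x ∈ u ++ m ∷ m ∷ v → x ≢ m → x ∈ u ++ v
    ∈-insertion⁻ []      v (here refl)         x≢m = ⊥-elim (x≢m refl)
    ∈-insertion⁻ []      v (there (here refl)) x≢m = ⊥-elim (x≢m refl)
    ∈-insertion⁻ []      v (there (there p))   _   = p
    ∈-insertion⁻ (y ∷ u) v (here eq)           _   = here eq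
    ∈-insertion⁻ (y ∷ u) v (there p)           x≢m = there (∈-insertion⁻ u v p x≢m)

    ∈-insertion⁺ : ∀ {x} (u v : List ℕ) → x ∈ u ++ v → x ∈ u ++ m ∷ m ∷ v
    ∈-insertion⁺ []      v p         = there (there p)
    ∈-insertion⁺ (y ∷ u) v (here eq) = here eq
    ∈-insertion⁺ (y ∷ u) v (there p) = there (∈-insertion⁺ u v p)

    LargerBefore-∉ : ∀ x ys → x ∉ ys → LargerBefore x ys
    LargerBefore-∉ x []       _    = tt
    LargerBefore-∉ x (y ∷ ys) x∉ys = (λ x∈ys → ⊥-elim (x∉ys (there x∈ys))) , LargerBefore-∉ x ys (x∉ys ∘ there)

    LargerBefore-insert : ∀ x (u v : List ℕ) → x < m → LargerBefore x (u ++ v) → LargerBefore x (u ++ m ∷ m ∷ v)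
    LargerBefore-insert x []      v x<m h        = (λ _ → x<m) , (λ _ → x<m) , h
    LargerBefore-insert x (y ∷ u) v x<m (h , hs) =
      (λ p → h (∈-insertion⁻ u v p (<⇒≢ x<m))) , LargerBefore-insert x u v x<m hs

    LargerBefore-remove : ∀ x (u v : List ℕ) → LargerBefore x (u ++ m ∷ m ∷ v) → LargerBefore x (u ++ v)
    LargerBefore-remove x []      v (_ , _ , h) = h
    LargerBefore-remove x (y ∷ u) v (h , hs)    = (h ∘ ∈-insertion⁺ u v) , LargerBefore-remove x u v hs

    Nested-insert : ∀ (u v : List ℕ) → All (_< m) (u ++ v) → Nested (u ++ v) → Nested (u ++ m ∷ m ∷ v)
    Nested-insert []      v all< nest =
      ((λ m∈v → ⊥-elim (m∉v m∈v)) , LargerBefore-∉ m v m∉v) , LargerBefore-∉ m v m∉v , nest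
      where
      m∉v : m ∉ v
      m∉v p = <-irrefl refl (All.lookup all< p)
    Nested-insert (x ∷ u) v (x<m ∷ all<) (h , nest) = LargerBefore-insert x u v x<m h , Nested-insert u v all< nest

    Nested-remove : ∀ (u v : List ℕ) → Nested (u ++ m ∷ m ∷ v) → Nested (u ++ v)
    Nested-remove []      v (_ , _ , nest) = nest
    Nested-remove (x ∷ u) v (h , nest)     = LargerBefore-remove x u v h , Nested-remove u v nest

    adjacent-maximum : ∀ σ → Nested σ → All (_≤ m) σ → 2 ≤ count m σ → ∃ λ u → ∃ λ v → σ ≡ u ++ m ∷ m ∷ v
    adjacent-maximum (x ∷ σ) (h , nest) (x≤m ∷ bnd) two with m ≟ x
    ... | no m≢x rewrite ≢⇒≡ᵇ≡false m≢x
          with u , v , refl ← adjacent-maximum σ nest bnd two = x ∷ u , v , refl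
    ... | yes refl rewrite ≡ᵇ-refl m with σ | h | bnd | count>0⇒∈ m σ (≤-pred two)
    ...   | y ∷ σ′ | m∈σ′⇒m<y , _ | y≤m ∷ _ | m∈yσ′ with y ≟ m
    ...     | yes refl = [] , σ′ , refl
    ...     | no  y≢m  = ⊥-elim (<⇒≱ (m∈σ′⇒m<y (tail-∈ m∈yσ′)) y≤m)
      where
      tail-∈ : m ∈ y ∷ σ′ → m ∈ σ′
      tail-∈ (here m≡y) = ⊥-elim (y≢m (sym m≡y))
      tail-∈ (there p)  = p

  count-pair-≡ : ∀ m (w : List ℕ) → count m (m ∷ m ∷ w) ≡ 2 + count m w
  count-pair-≡ m w rewrite ≡ᵇ-refl m = refl

  count-pair-≢ : ∀ {a m} (w : List ℕ) → a ≢ m → count a (m ∷ m ∷ w) ≡ count a w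
  count-pair-≢ w a≢m rewrite ≢⇒≡ᵇ≡false a≢m = refl

  insert-Stirling : ∀ {n τ σ} → Stirling n τ → σ ∈ insertions (suc n) τ → Stirling (suc n) σ
  insert-Stirling {n} {τ} (mkStirling len bnd tw nest) p with u , v , refl , refl ← ∈-insertions⁻ (suc n) τ p =
    mkStirling
      (trans (length-insertion m u v) (trans (cong (2 +_) len) (sym (*-suc 2 n))))
      (All.++⁺ (All.map weaken (All.++⁻ˡ u bnd)) (top ∷ top ∷ All.map weaken (All.++⁻ʳ u bnd)))
      twice′
      (Nested-insert m u v (All.map (s≤s ∘ proj₂) bnd) nest)
    where
    m : ℕ
    m = suc n
    weaken : ∀ {a} → 1 ≤ a × a ≤ n → 1 ≤ a × a ≤ m
    weaken (1≤a , a≤n) = 1≤a , m≤n⇒m≤1+n a≤n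
    top : 1 ≤ m × m ≤ m
    top = s≤s z≤n , ≤-refl
    twice′ : ∀ k → k < m → count (suc k) (u ++ m ∷ m ∷ v) ≡ 2
    twice′ k k<m rewrite count-insertion (suc k) m u v with k ≟ n
    ... | yes refl = trans (count-pair-≡ m (u ++ v)) (cong (2 +_) (count-∉ m (u ++ v) m∉uv))
      where
      m∉uv : m ∉ u ++ v
      m∉uv q = <-irrefl refl (proj₂ (All.lookup bnd q))
    ... | no k≢n = trans (count-pair-≢ (u ++ v) (k≢n ∘ suc-injective)) (tw k (≤∧≢⇒< (≤-pred k<m) k≢n))

  remove-Stirling : ∀ {n} u v → Stirling (suc n) (u ++ suc n ∷ suc n ∷ v) → Stirling n (u ++ v)
  remove-Stirling {n} u v (mkStirling len bnd tw nest) =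
    mkStirling
      (suc-injective (suc-injective (trans (sym (length-insertion m u v)) (trans len (*-suc 2 n)))))
      (All.tabulate bounded′)
      (λ k k<n → trans (sym (count-pair-≢ (u ++ v) (<⇒≢ (s≤s k<n))))
                       (trans (sym (count-insertion (suc k) m u v)) (tw k (m≤n⇒m≤1+n k<n))))
      (Nested-remove m u v nest)
    where
    m : ℕ
    m = suc n
    m-absent : count m (u ++ v) ≡ 0
    m-absent = +-cancelˡ-≡ 2 _ 0 (trans (sym (count-pair-≡ m (u ++ v)))
                                       (trans (sym (count-insertion m m u v)) (tw n ≤-refl)))
    bounded′ : ∀ {a} → a ∈ u ++ v → 1 ≤ a × a ≤ n
    bounded′ {a} a∈ with 1≤a , a≤m ← All.lookup bnd (∈-insertion⁺ m u v a∈) =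
      1≤a , ≤-pred (≤∧≢⇒< a≤m λ { refl → <⇒≢ (∈⇒count>0 m (u ++ v) a∈) (sym m-absent) })

  Stirling-suc⇒∈-insertions : ∀ {n σ} → Stirling (suc n) σ → ∃ λ τ → Stirling n τ × σ ∈ insertions (suc n) τ
  Stirling-suc⇒∈-insertions {n} s
    with u , v , refl ← adjacent-maximum (suc n) _ (nested s) (All.map proj₂ (bounded s))
                                         (≤-reflexive (sym (twice s n ≤-refl))) =
    u ++ v , remove-Stirling u v s , ∈-insertions⁺ (suc n) u v

  countᵇ-𝒬-suc : ∀ n (P : List ℕ → Bool) → countᵇ P (𝒬 (suc n)) ≡ sum (map (countᵇ P ∘ insertions (suc n)) (𝒬 n))
  countᵇ-𝒬-suc n P =
    trans (countᵇ-unique-sameElements P (𝒬-unique (suc n)) insertions-𝒬-unique 𝒬-suc⊆ ⊆𝒬-suc)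
          (countᵇ-concatMap P (insertions m) (𝒬 n))
    where
    m : ℕ
    m = suc n
    m∉ : ∀ {τ} → Stirling n τ → m ∉ τ
    m∉ s p = <-irrefl refl (proj₂ (All.lookup (bounded s) p))
    insertions-𝒬-unique : Unique (concatMap (insertions m) (𝒬 n))
    insertions-𝒬-unique = Unique.concat⁺
      (All.map⁺ (All.tabulate (λ τ∈ → insertions-unique m _ (m∉ (∈𝒬⇒Stirling τ∈)))))
      (AllPairs.map⁺ (AllPairs-map-All
        (λ {τ} {τ′} s s′ τ≢τ′ {σ} (p , p′) →
          τ≢τ′ (trans (sym (removePair-∈-insertions m τ (m∉ s) p)) (removePair-∈-insertions m τ′ (m∉ s′) p′)))
        (All.tabulate ∈𝒬⇒Stirling) (𝒬-unique n)))
    𝒬-suc⊆ : ∀ {σ} → σ ∈ 𝒬 (suc n) → σ ∈ concatMap (insertions m) (𝒬 n)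
    𝒬-suc⊆ p with τ , s , q ← Stirling-suc⇒∈-insertions (∈𝒬⇒Stirling p) =
      ∈-concatMap⁺ (insertions m) (Any.map (λ { refl → q }) (Stirling⇒∈𝒬 s))
    ⊆𝒬-suc : ∀ {σ} → σ ∈ concatMap (insertions m) (𝒬 n) → σ ∈ 𝒬 (suc n)
    ⊆𝒬-suc p with _ , τ∈ , q ← find (∈-concatMap⁻ (insertions m) {xs = 𝒬 n} p) =
      Stirling⇒∈𝒬 (insert-Stirling (∈𝒬⇒Stirling τ∈) q)

  countᵇ-upTo-suc : (P : ℕ → Bool) (k : ℕ) → countᵇ P (upTo (suc k)) ≡ boolToℕ (P 0) + countᵇ (P ∘ suc) (upTo k)
  countᵇ-upTo-suc P k =
    trans (countᵇ-∷ P 0 (applyUpTo suc k))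
          (cong (boolToℕ (P 0) +_) (trans (cong (countᵇ P) (sym (map-upTo suc k))) (countᵇ-map P suc (upTo k))))

  countᵇ-upTo-∷ʳ : (P : ℕ → Bool) (k : ℕ) → countᵇ P (upTo (suc k)) ≡ countᵇ P (upTo k) + boolToℕ (P k)
  countᵇ-upTo-∷ʳ P k = begin
    countᵇ P (upTo (suc k))                    ≡⟨ cong (countᵇ P) (upTo-∷ʳ k) ⟨
    countᵇ P (upTo k ++ k ∷ [])                ≡⟨ countᵇ-++ P (upTo k) (k ∷ []) ⟩
    countᵇ P (upTo k) + countᵇ P (k ∷ [])      ≡⟨ cong (countᵇ P (upTo k) +_) (countᵇ-∷ P k []) ⟩
    countᵇ P (upTo k) + (boolToℕ (P k) + 0)    ≡⟨ cong (countᵇ P (upTo k) +_) (+-identityʳ _) ⟩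
    countᵇ P (upTo k) + boolToℕ (P k)          ∎
    where open ≡-Reasoning

  pairCount : (ℕ → ℕ → Bool) → List ℕ → ℕ
  pairCount f (a ∷ b ∷ l) = boolToℕ (f a b) + pairCount f (b ∷ l)
  pairCount f _           = 0

  tripleCount : (ℕ → ℕ → ℕ → Bool) → List ℕ → ℕ
  tripleCount f (a ∷ b ∷ c ∷ l) = boolToℕ (f a b c) + tripleCount f (b ∷ c ∷ l)
  tripleCount f _               = 0

  pairCount-upTo : ∀ f L → pairCount f L ≡ countᵇ (λ i → f (at L i) (at L (suc i))) (upTo (length L ∸ 1))
  pairCount-upTo f []          = refl
  pairCount-upTo f (a ∷ [])    = refl
  pairCount-upTo f (a ∷ b ∷ l) =
    trans (cong (boolToℕ (f a b) +_) (pairCount-upTo f (b ∷ l)))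
          (sym (countᵇ-upTo-suc (λ i → f (at (a ∷ b ∷ l) i) (at (a ∷ b ∷ l) (suc i))) (length l)))

  tripleCount-upTo : ∀ f L →
    tripleCount f L ≡ countᵇ (λ i → f (at L i) (at L (suc i)) (at L (suc (suc i)))) (upTo (length L ∸ 2))
  tripleCount-upTo f []              = refl
  tripleCount-upTo f (a ∷ [])        = refl
  tripleCount-upTo f (a ∷ b ∷ [])    = refl
  tripleCount-upTo f (a ∷ b ∷ c ∷ l) =
    trans (cong (boolToℕ (f a b c) +_) (tripleCount-upTo f (b ∷ c ∷ l)))
          (sym (countᵇ-upTo-suc (λ i → f (at L i) (at L (suc i)) (at L (suc (suc i)))) (length l)))
    where
    L : List ℕ
    L = a ∷ b ∷ c ∷ l

  plateaus : (ℕ → ℕ → Bool) → List ℕ → ℕ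
  plateaus g = tripleCount (λ a b c → g a b ∧ (b ≡ᵇ c))

  descents ascentPlateaus descentPlateaus : List ℕ → ℕ
  descents        = pairCount (λ a b → b <ᵇ a)
  ascentPlateaus  = plateaus _<ᵇ_
  descentPlateaus = plateaus (λ a b → b <ᵇ a)

  length-pad : ∀ σ → length (pad σ) ≡ 2 + length σ
  length-pad σ = cong suc (trans (length-++ σ) (+-comm (length σ) 1))

  at-pad-last : ∀ σ → at (pad σ) (suc (length σ)) ≡ 0
  at-pad-last []      = refl
  at-pad-last (x ∷ σ) = at-pad-last σ

  at-pad : ∀ σ {k} → k < length σ → at (pad σ) (suc k) ≡ at σ k
  at-pad (x ∷ σ) {zero}  _        = refl
  at-pad (x ∷ σ) {suc k} (s≤s k<) = at-pad σ k<

  des≡descents-pad : ∀ σ → des σ ≡ descents (pad σ)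
  des≡descents-pad σ =
    trans (countᵇ-map descent (0 +_) (upTo (suc (length σ))))
          (sym (trans (pairCount-upTo (λ a b → b <ᵇ a) (pad σ))
                      (cong (λ k → countᵇ descent (upTo (k ∸ 1))) (length-pad σ))))
    where
    descent : ℕ → Bool
    descent i = at (pad σ) (suc i) <ᵇ at (pad σ) i

  -- laplat and desp range over i ∈ [1, 2n); the padded word has one more window, i = 2n,
  -- which never counts since σ_{2n+1} = 0 < σ_{2n}.
  countRange-plateaus : ∀ g σ → All (1 ≤_) σ →
    countRange 1 (length σ) (λ i → g (at (pad σ) (i ∸ 1)) (at (pad σ) i) ∧ (at (pad σ) i ≡ᵇ at (pad σ) (suc i)))
    ≡ plateaus g (pad σ)
  countRange-plateaus g σ pos = begin
    countᵇ _ (map (1 +_) (upTo (length σ ∸ 1)))   ≡⟨ countᵇ-map _ (1 +_) (upTo (length σ ∸ 1)) ⟩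
    countᵇ window (upTo (length σ ∸ 1))           ≡⟨ drop-last (length σ) refl ⟨
    countᵇ window (upTo (length σ))               ≡⟨ cong (λ k → countᵇ window (upTo (k ∸ 2))) (length-pad σ) ⟨
    countᵇ window (upTo (length (pad σ) ∸ 2))     ≡⟨ tripleCount-upTo _ (pad σ) ⟨
    plateaus g (pad σ)                            ∎
    where
    open ≡-Reasoning
    L : List ℕ
    L = pad σ
    window : ℕ → Bool
    window t = g (at L t) (at L (suc t)) ∧ (at L (suc t) ≡ᵇ at L (suc (suc t)))
    last-window : ∀ k → length σ ≡ suc k → window k ≡ false
    last-window k eq = trans (cong (g (at L k) (at L (suc k)) ∧_) ends) (∧-zeroʳ _)
      where
      k< : k < length σ
      k< = subst (k <_) (sym eq) ≤-refl
      ends : (at L (suc k) ≡ᵇ at L (suc (suc k))) ≡ false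
      ends rewrite at-pad σ k< | subst (λ j → at L (suc j) ≡ 0) eq (at-pad-last σ)
        with at σ k | All.lookup pos (at-∈ σ k<)
      ... | suc _ | _ = refl
    drop-last : ∀ k → length σ ≡ k → countᵇ window (upTo k) ≡ countᵇ window (upTo (k ∸ 1))
    drop-last zero    _  = refl
    drop-last (suc k) eq = trans (countᵇ-upTo-∷ʳ window k)
                                 (trans (cong (λ b → countᵇ window (upTo k) + boolToℕ b) (last-window k eq))
                                        (+-identityʳ _))

  Stat : Set
  Stat = ℕ × ℕ × ℕ

  stat : List ℕ → Stat
  stat σ = des σ , laplat σ , desp σ

  wordStat : List ℕ → Stat
  wordStat L = descents L , ascentPlateaus L , descentPlateaus L

  stat≡wordStat-pad : ∀ σ → All (1 ≤_) σ → stat σ ≡ wordStat (pad σ)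
  stat≡wordStat-pad σ pos =
    cong₂ _,_ (des≡descents-pad σ)
              (cong₂ _,_ (countRange-plateaus _<ᵇ_ σ pos) (countRange-plateaus (λ a b → b <ᵇ a) σ pos))

  padInsertions : ℕ → List ℕ → List (List ℕ)
  padInsertions m (a ∷ b ∷ l) = (a ∷ m ∷ m ∷ b ∷ l) ∷ map (a ∷_) (padInsertions m (b ∷ l))
  padInsertions m _           = []

  map-pad-insertions : ∀ m c τ → map (λ σ → c ∷ σ ++ 0 ∷ []) (insertions m τ) ≡ padInsertions m (c ∷ τ ++ 0 ∷ [])
  map-pad-insertions m c []      = refl
  map-pad-insertions m c (x ∷ τ) = cong ((c ∷ m ∷ m ∷ x ∷ τ ++ 0 ∷ []) ∷_) (begin
    map (λ σ → c ∷ σ ++ 0 ∷ []) (map (x ∷_) (insertions m τ))   ≡⟨ map-∘ (insertions m τ) ⟨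
    map (λ σ → c ∷ x ∷ σ ++ 0 ∷ []) (insertions m τ)            ≡⟨ map-∘ (insertions m τ) ⟩
    map (c ∷_) (map (λ σ → x ∷ σ ++ 0 ∷ []) (insertions m τ))   ≡⟨ cong (map (c ∷_)) (map-pad-insertions m x τ) ⟩
    map (c ∷_) (padInsertions m (x ∷ τ ++ 0 ∷ []))             ∎)
    where open ≡-Reasoning

  data Gap : Set where
    descent inAscentPlateau inDescentPlateau beforePlateau ascent : Gap

  -- Shifted g s s′: inserting m m into a gap of type g turns the statistics s into s′.
  Shifted : Gap → Stat → Stat → Set
  Shifted descent          (d , l , p) (d′ , l′ , p′) = d′ ≡ d     × l′ ≡ suc l × p′ ≡ p
  Shifted inAscentPlateau  (d , l , p) (d′ , l′ , p′) = d′ ≡ suc d × l′ ≡ l     × p′ ≡ p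
  Shifted inDescentPlateau (d , l , p) (d′ , l′ , p′) = d′ ≡ suc d × l′ ≡ suc l × suc p′ ≡ p
  Shifted beforePlateau    (d , l , p) (d′ , l′ , p′) = d′ ≡ suc d × l′ ≡ l     × p′ ≡ suc p
  Shifted ascent           (d , l , p) (d′ , l′ , p′) = d′ ≡ suc d × l′ ≡ suc l × p′ ≡ p

  plateauGap : ℕ → ℕ → Gap
  plateauGap c a = if c <ᵇ a then inAscentPlateau else inDescentPlateau

  ascentGap : ℕ → List ℕ → Gap
  ascentGap b []       = ascent
  ascentGap b (b′ ∷ _) = if b ≡ᵇ b′ then beforePlateau else ascent

  gapType : ℕ → ℕ → ℕ → List ℕ → Gap
  gapType c a b l = if b <ᵇ a then descent else if a ≡ᵇ b then plateauGap c a else ascentGap b l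

  gapTypes : ℕ → List ℕ → List Gap
  gapTypes c (a ∷ b ∷ l) = gapType c a b l ∷ gapTypes a (b ∷ l)
  gapTypes c _           = []

  NoTripleRepeat : List ℕ → Set
  NoTripleRepeat (a ∷ b ∷ c ∷ l) = ¬ (a ≡ b × b ≡ c) × NoTripleRepeat (b ∷ c ∷ l)
  NoTripleRepeat _               = ⊤

  _⊞_ : Stat → Stat → Stat
  (d , l , p) ⊞ (d′ , l′ , p′) = d + d′ , l + l′ , p + p′

  Shifted-⊞ : ∀ g f s s′ → Shifted g s s′ → Shifted g (f ⊞ s) (f ⊞ s′)
  Shifted-⊞ descent          (f₁ , f₂ , f₃) s       s′ (refl , refl , refl) = refl , +-suc f₂ _ , refl
  Shifted-⊞ inAscentPlateau  (f₁ , f₂ , f₃) s       s′ (refl , refl , refl) = +-suc f₁ _ , refl , refl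
  Shifted-⊞ inDescentPlateau (f₁ , f₂ , f₃) s (_ , _ , p′) (refl , refl , refl) = +-suc f₁ _ , +-suc f₂ _ , sym (+-suc f₃ p′)
  Shifted-⊞ beforePlateau    (f₁ , f₂ , f₃) s       s′ (refl , refl , refl) = +-suc f₁ _ , refl , +-suc f₃ _
  Shifted-⊞ ascent           (f₁ , f₂ , f₃) s       s′ (refl , refl , refl) = +-suc f₁ _ , +-suc f₂ _ , refl

  -- wordStat (c ∷ a ∷ b ∷ X) ≡ headStat c a b ⊞ wordStat (a ∷ b ∷ X) holds by definition.
  headStat : ℕ → ℕ → ℕ → Stat
  headStat c a b = boolToℕ (a <ᵇ c) , boolToℕ ((c <ᵇ a) ∧ (a ≡ᵇ b)) , boolToℕ ((a <ᵇ c) ∧ (a ≡ᵇ b))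

  <ᵇ-true : ∀ {a b} → a < b → (a <ᵇ b) ≡ true
  <ᵇ-true {a} {b} a<b with a <ᵇ b in eq
  ... | true  = refl
  ... | false = ⊥-elim (subst T eq (<⇒<ᵇ a<b))

  <ᵇ-false : ∀ {a b} → b ≤ a → (a <ᵇ b) ≡ false
  <ᵇ-false {a} {b} b≤a with a <ᵇ b in eq
  ... | false = refl
  ... | true  = ⊥-elim (<⇒≱ (<ᵇ⇒< a b (subst T (sym eq) tt)) b≤a)

  module _ {m : ℕ} where

    -- The windows through the inserted m m contribute one left ascent-plateau (a < m = m), one
    -- descent (m > b), and a descent-plateau iff b starts a plateau; the cases compare this with
    -- the contribution of the windows through a b.
    gap-shift : ∀ c a b l → NoTripleRepeat (c ∷ a ∷ b ∷ l) → a < m → b < m →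
                Shifted (gapType c a b l) (wordStat (c ∷ a ∷ b ∷ l)) (wordStat (c ∷ a ∷ m ∷ m ∷ b ∷ l))
    gap-shift c a b l (c≢a≡b , nt) a<m b<m
      rewrite <ᵇ-false {m} {a} (<⇒≤ a<m) | ≡ᵇ-refl m | <ᵇ-false {m} {m} ≤-refl | <ᵇ-true a<m | <ᵇ-true b<m
            | ≢⇒≡ᵇ≡false (<⇒≢ a<m) | ∧-zeroʳ (c <ᵇ a) | ∧-zeroʳ (a <ᵇ c)
      with <-cmp c a | <-cmp a b
    gap-shift c a b [] _ _ b<m | _ | tri< a<b _ _
      rewrite <ᵇ-false (<⇒≤ a<b) | ≢⇒≡ᵇ≡false (<⇒≢ a<b) | ∧-zeroʳ (c <ᵇ a) | ∧-zeroʳ (a <ᵇ c)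
      = +-suc (boolToℕ (a <ᵇ c)) 0 , refl , refl
    gap-shift c a b (b′ ∷ l) _ _ b<m | _ | tri< a<b _ _
      rewrite <ᵇ-false (<⇒≤ a<b) | ≢⇒≡ᵇ≡false (<⇒≢ a<b) | ∧-zeroʳ (c <ᵇ a) | ∧-zeroʳ (a <ᵇ c)
            | <ᵇ-true a<b | <ᵇ-false {m} {b} (<⇒≤ b<m) | <ᵇ-true b<m
      with b ≟ b′
    ... | yes refl rewrite ≡ᵇ-refl b = +-suc (boolToℕ (a <ᵇ c)) _ , refl , refl
    ... | no b≢b′  rewrite ≢⇒≡ᵇ≡false b≢b′ = +-suc (boolToℕ (a <ᵇ c)) _ , refl , refl
    gap-shift c a b [] _ _ b<m | _ | tri> _ _ b<a
      rewrite <ᵇ-true b<a | ≢⇒≡ᵇ≡false (≢-sym (<⇒≢ b<a)) | ∧-zeroʳ (c <ᵇ a) | ∧-zeroʳ (a <ᵇ c)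
      = refl , refl , refl
    gap-shift c a b (b′ ∷ l) _ _ b<m | _ | tri> _ _ b<a
      rewrite <ᵇ-true b<a | ≢⇒≡ᵇ≡false (≢-sym (<⇒≢ b<a)) | ∧-zeroʳ (c <ᵇ a) | ∧-zeroʳ (a <ᵇ c)
            | <ᵇ-false (<⇒≤ b<a) | <ᵇ-false {m} {b} (<⇒≤ b<m) | <ᵇ-true b<m
      = refl , refl , refl
    gap-shift c a a l (c≢a≡a , _) _ _ | tri≈ _ refl _ | tri≈ _ refl _ = ⊥-elim (c≢a≡a (refl , refl))
    gap-shift c a a [] _ _ _ | tri< c<a _ _ | tri≈ _ refl _
      rewrite <ᵇ-false {a} {a} ≤-refl | ≡ᵇ-refl a | <ᵇ-true c<a | <ᵇ-false (<⇒≤ c<a)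
      = refl , refl , refl
    gap-shift c a a (b′ ∷ l) (_ , a≢a≡b′ , _) a<m _ | tri< c<a _ _ | tri≈ _ refl _
      rewrite <ᵇ-false {a} {a} ≤-refl | ≡ᵇ-refl a | <ᵇ-true c<a | <ᵇ-false (<⇒≤ c<a)
            | <ᵇ-false {m} {a} (<⇒≤ a<m) | <ᵇ-true a<m | ≢⇒≡ᵇ≡false {a} {b′} (λ eq → a≢a≡b′ (refl , eq))
      = refl , refl , refl
    gap-shift c a a [] _ _ _ | tri> _ _ a<c | tri≈ _ refl _
      rewrite <ᵇ-false {a} {a} ≤-refl | ≡ᵇ-refl a | <ᵇ-true a<c | <ᵇ-false (<⇒≤ a<c)
      = refl , refl , refl
    gap-shift c a a (b′ ∷ l) (_ , a≢a≡b′ , _) a<m _ | tri> _ _ a<c | tri≈ _ refl _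
      rewrite <ᵇ-false {a} {a} ≤-refl | ≡ᵇ-refl a | <ᵇ-true a<c | <ᵇ-false (<⇒≤ a<c)
            | <ᵇ-false {m} {a} (<⇒≤ a<m) | <ᵇ-true a<m | ≢⇒≡ᵇ≡false {a} {b′} (λ eq → a≢a≡b′ (refl , eq))
      = refl , refl , refl

    padInsertions-head : ∀ b l → All (λ X → ∃ λ X′ → X ≡ b ∷ X′) (padInsertions m (b ∷ l))
    padInsertions-head b []       = []
    padInsertions-head b (b′ ∷ l) = (_ , refl) ∷ All.map⁺ (All.tabulate (λ {X} _ → X , refl))

    gaps-shift : ∀ c L → NoTripleRepeat (c ∷ L) → All (_< m) L →
      Pointwise (λ X g → Shifted g (wordStat (c ∷ L)) (wordStat (c ∷ X))) (padInsertions m L) (gapTypes c L)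
    gaps-shift c []          _  _                  = []
    gaps-shift c (a ∷ [])    _  _                  = []
    gaps-shift c (a ∷ b ∷ l) nt (a<m ∷ b<m ∷ all<) =
      gap-shift c a b l nt a<m b<m ∷ prepend (padInsertions-head b l) (gaps-shift a (b ∷ l) (proj₂ nt) (b<m ∷ all<))
      where
      prepend : ∀ {Xs gs} → All (λ X → ∃ λ X′ → X ≡ b ∷ X′) Xs →
        Pointwise (λ X g → Shifted g (wordStat (a ∷ b ∷ l)) (wordStat (a ∷ X))) Xs gs →
        Pointwise (λ X g → Shifted g (wordStat (c ∷ a ∷ b ∷ l)) (wordStat (c ∷ X))) (map (a ∷_) Xs) gs
      prepend []                 []       = []
      prepend ((_ , refl) ∷ hds) (r ∷ rs) = Shifted-⊞ _ (headStat c a b) _ _ r ∷ prepend hds rs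

  gapIndex : Gap → ℕ
  gapIndex descent          = 0
  gapIndex inAscentPlateau  = 1
  gapIndex inDescentPlateau = 2
  gapIndex beforePlateau    = 3
  gapIndex ascent           = 4

  _≡ᵍ_ : Gap → Gap → Bool
  g ≡ᵍ h = gapIndex g ≡ᵇ gapIndex h

  occurrences : Gap → List Gap → ℕ
  occurrences g = countᵇ (_≡ᵍ g)

  occurrences-∷ : ∀ g x gs → occurrences g (x ∷ gs) ≡ boolToℕ (x ≡ᵍ g) + occurrences g gs
  occurrences-∷ g = countᵇ-∷ (_≡ᵍ g)

  allGaps : List Gap
  allGaps = descent ∷ inAscentPlateau ∷ inDescentPlateau ∷ beforePlateau ∷ ascent ∷ []

  sum-map-by-type : ∀ (f : Gap → ℕ) gs → sum (map f gs) ≡ sum (map (λ g → occurrences g gs * f g) allGaps)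
  sum-map-by-type f []       = sym (sum-map-zero _ allGaps (λ _ → refl))
  sum-map-by-type f (y ∷ gs) = begin
    f y + sum (map f gs)
      ≡⟨ cong₂ _+_ (select y) (sym (sum-map-by-type f gs)) ⟨
    sum (map (λ g → boolToℕ (y ≡ᵍ g) * f g) allGaps) + sum (map (λ g → occurrences g gs * f g) allGaps)
      ≡⟨ sum-map-+ (λ g → boolToℕ (y ≡ᵍ g) * f g) (λ g → occurrences g gs * f g) allGaps ⟨
    sum (map (λ g → boolToℕ (y ≡ᵍ g) * f g + occurrences g gs * f g) allGaps)
      ≡⟨ sum-map-cong-∈ _ _ allGaps (λ {g} _ →
           trans (sym (*-distribʳ-+ (f g) (boolToℕ (y ≡ᵍ g)) _)) (cong (_* f g) (sym (countᵇ-∷ (_≡ᵍ g) y gs)))) ⟩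
    sum (map (λ g → occurrences g (y ∷ gs) * f g) allGaps) ∎
    where
    open ≡-Reasoning
    select : ∀ y → sum (map (λ g → boolToℕ (y ≡ᵍ g) * f g) allGaps) ≡ f y
    select descent          = trans (+-identityʳ _) (+-identityʳ _)
    select inAscentPlateau  = trans (+-identityʳ _) (+-identityʳ _)
    select inDescentPlateau = trans (+-identityʳ _) (+-identityʳ _)
    select beforePlateau    = trans (+-identityʳ _) (+-identityʳ _)
    select ascent           = trans (+-identityʳ _) (+-identityʳ _)

  length≡sum-occurrences : ∀ gs → length gs ≡ sum (map (λ g → occurrences g gs) allGaps)
  length≡sum-occurrences gs = begin
    length gs                                               ≡⟨ length≡sum-ones gs ⟩
    sum (map (λ _ → 1) gs)                                  ≡⟨ sum-map-by-type (λ _ → 1) gs ⟩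
    sum (map (λ g → occurrences g gs * 1) allGaps)          ≡⟨ sum-map-cong-∈ _ (λ g → occurrences g gs) allGaps (λ _ → *-identityʳ _) ⟩
    sum (map (λ g → occurrences g gs) allGaps)              ∎
    where
    open ≡-Reasoning
    length≡sum-ones : ∀ (xs : List Gap) → length xs ≡ sum (map (λ _ → 1) xs)
    length≡sum-ones []       = refl
    length≡sum-ones (_ ∷ xs) = cong suc (length≡sum-ones xs)

  length-gapTypes : ∀ c L → length (gapTypes c L) ≡ length L ∸ 1
  length-gapTypes c []          = refl
  length-gapTypes c (a ∷ [])    = refl
  length-gapTypes c (a ∷ b ∷ l) = cong suc (length-gapTypes a (b ∷ l))

  ascentGap-≡ᵍ : ∀ b l g → (beforePlateau ≡ᵍ g) ≡ false → (ascent ≡ᵍ g) ≡ false → (ascentGap b l ≡ᵍ g) ≡ false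
  ascentGap-≡ᵍ b []       g _ ≢ascent = ≢ascent
  ascentGap-≡ᵍ b (b′ ∷ _) g ≢before ≢ascent with b ≡ᵇ b′
  ... | true  = ≢before
  ... | false = ≢ascent

  plateauGap-≡ᵍ : ∀ c a g → (inAscentPlateau ≡ᵍ g) ≡ false → (inDescentPlateau ≡ᵍ g) ≡ false → (plateauGap c a ≡ᵍ g) ≡ false
  plateauGap-≡ᵍ c a g ≢asc ≢desc with c <ᵇ a
  ... | true  = ≢asc
  ... | false = ≢desc

  occurrences-descent : ∀ c L → occurrences descent (gapTypes c L) ≡ descents L
  occurrences-descent c []          = refl
  occurrences-descent c (a ∷ [])    = refl
  occurrences-descent c (a ∷ b ∷ l) =
    trans (occurrences-∷ descent (gapType c a b l) (gapTypes a (b ∷ l)))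
          (cong₂ _+_ (cong boolToℕ isDescent) (occurrences-descent a (b ∷ l)))
    where
    isDescent : (gapType c a b l ≡ᵍ descent) ≡ (b <ᵇ a)
    isDescent with <-cmp a b
    ... | tri< a<b _ _  rewrite <ᵇ-false (<⇒≤ a<b) | ≢⇒≡ᵇ≡false (<⇒≢ a<b) = ascentGap-≡ᵍ b l descent refl refl
    ... | tri≈ _ refl _ rewrite <ᵇ-false {a} ≤-refl | ≡ᵇ-refl a = plateauGap-≡ᵍ c a descent refl refl
    ... | tri> _ _ b<a  rewrite <ᵇ-true b<a = refl

  occurrences-inAscentPlateau : ∀ c L → occurrences inAscentPlateau (gapTypes c L) ≡ ascentPlateaus (c ∷ L)
  occurrences-inAscentPlateau c []          = refl
  occurrences-inAscentPlateau c (a ∷ [])    = refl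
  occurrences-inAscentPlateau c (a ∷ b ∷ l) =
    trans (occurrences-∷ inAscentPlateau (gapType c a b l) (gapTypes a (b ∷ l)))
          (cong₂ _+_ (cong boolToℕ isInAscentPlateau) (occurrences-inAscentPlateau a (b ∷ l)))
    where
    isInAscentPlateau : (gapType c a b l ≡ᵍ inAscentPlateau) ≡ ((c <ᵇ a) ∧ (a ≡ᵇ b))
    isInAscentPlateau with <-cmp a b
    ... | tri< a<b _ _  rewrite <ᵇ-false (<⇒≤ a<b) | ≢⇒≡ᵇ≡false (<⇒≢ a<b) | ∧-zeroʳ (c <ᵇ a) =
      ascentGap-≡ᵍ b l inAscentPlateau refl refl
    ... | tri> _ _ b<a  rewrite <ᵇ-true b<a | ≢⇒≡ᵇ≡false (≢-sym (<⇒≢ b<a)) | ∧-zeroʳ (c <ᵇ a) = refl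
    ... | tri≈ _ refl _ rewrite <ᵇ-false {a} ≤-refl | ≡ᵇ-refl a | ∧-identityʳ (c <ᵇ a) with c <ᵇ a
    ...   | true  = refl
    ...   | false = refl

  occurrences-inDescentPlateau : ∀ c L → NoTripleRepeat (c ∷ L) →
                                 occurrences inDescentPlateau (gapTypes c L) ≡ descentPlateaus (c ∷ L)
  occurrences-inDescentPlateau c []          _ = refl
  occurrences-inDescentPlateau c (a ∷ [])    _ = refl
  occurrences-inDescentPlateau c (a ∷ b ∷ l) (c≢a≡b , nt) =
    trans (occurrences-∷ inDescentPlateau (gapType c a b l) (gapTypes a (b ∷ l)))
          (cong₂ _+_ (cong boolToℕ isInDescentPlateau) (occurrences-inDescentPlateau a (b ∷ l) nt))
    where
    isInDescentPlateau : (gapType c a b l ≡ᵍ inDescentPlateau) ≡ ((a <ᵇ c) ∧ (a ≡ᵇ b))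
    isInDescentPlateau with <-cmp a b
    ... | tri< a<b _ _  rewrite <ᵇ-false (<⇒≤ a<b) | ≢⇒≡ᵇ≡false (<⇒≢ a<b) | ∧-zeroʳ (a <ᵇ c) =
      ascentGap-≡ᵍ b l inDescentPlateau refl refl
    ... | tri> _ _ b<a  rewrite <ᵇ-true b<a | ≢⇒≡ᵇ≡false (≢-sym (<⇒≢ b<a)) | ∧-zeroʳ (a <ᵇ c) = refl
    ... | tri≈ _ refl _ rewrite <ᵇ-false {a} ≤-refl | ≡ᵇ-refl a | ∧-identityʳ (a <ᵇ c) with <-cmp c a
    ...   | tri< c<a _ _ rewrite <ᵇ-true c<a | <ᵇ-false (<⇒≤ c<a) = refl
    ...   | tri≈ _ c≡a _ = ⊥-elim (c≢a≡b (c≡a , refl))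
    ...   | tri> _ _ a<c rewrite <ᵇ-false (<⇒≤ a<c) | <ᵇ-true a<c = refl

  occurrences-beforePlateau : ∀ c L → occurrences beforePlateau (gapTypes c L) ≡ ascentPlateaus L
  occurrences-beforePlateau c []               = refl
  occurrences-beforePlateau c (a ∷ [])         = refl
  occurrences-beforePlateau c (a ∷ b ∷ [])     =
    trans (occurrences-∷ beforePlateau (gapType c a b []) []) (cong (λ x → boolToℕ x + 0) notBeforePlateau)
    where
    notBeforePlateau : (gapType c a b [] ≡ᵍ beforePlateau) ≡ false
    notBeforePlateau with <-cmp a b
    ... | tri< a<b _ _  rewrite <ᵇ-false (<⇒≤ a<b) | ≢⇒≡ᵇ≡false (<⇒≢ a<b) = refl
    ... | tri≈ _ refl _ rewrite <ᵇ-false {a} ≤-refl | ≡ᵇ-refl a = plateauGap-≡ᵍ c a beforePlateau refl refl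
    ... | tri> _ _ b<a  rewrite <ᵇ-true b<a = refl
  occurrences-beforePlateau c (a ∷ b ∷ b′ ∷ l) =
    trans (occurrences-∷ beforePlateau (gapType c a b (b′ ∷ l)) (gapTypes a (b ∷ b′ ∷ l)))
          (cong₂ _+_ (cong boolToℕ isBeforePlateau) (occurrences-beforePlateau a (b ∷ b′ ∷ l)))
    where
    isBeforePlateau : (gapType c a b (b′ ∷ l) ≡ᵍ beforePlateau) ≡ ((a <ᵇ b) ∧ (b ≡ᵇ b′))
    isBeforePlateau with <-cmp a b
    ... | tri< a<b _ _  rewrite <ᵇ-false (<⇒≤ a<b) | ≢⇒≡ᵇ≡false (<⇒≢ a<b) | <ᵇ-true a<b with b ≡ᵇ b′
    ...   | true  = refl
    ...   | false = refl
    isBeforePlateau | tri≈ _ refl _ rewrite <ᵇ-false {a} ≤-refl | ≡ᵇ-refl a = plateauGap-≡ᵍ c a beforePlateau refl refl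
    isBeforePlateau | tri> _ _ b<a  rewrite <ᵇ-true b<a | <ᵇ-false (<⇒≤ b<a) = refl

  _≡ˢ_ : Stat → Stat → Bool
  (d , l , p) ≡ˢ (d′ , l′ , p′) = (d ≡ᵇ d′) ∧ (l ≡ᵇ l′) ∧ (p ≡ᵇ p′)

  ≡ˢ⇒≡ : ∀ s t → T (s ≡ˢ t) → s ≡ t
  ≡ˢ⇒≡ (d , l , p) (d′ , l′ , p′) eq =
    let (d≡ , eq′) = T-∧⁻ {d ≡ᵇ d′} eq ; (l≡ , p≡) = T-∧⁻ {l ≡ᵇ l′} eq′ in
    cong₂ _,_ (≡ᵇ⇒≡ d d′ d≡) (cong₂ _,_ (≡ᵇ⇒≡ l l′ l≡) (≡ᵇ⇒≡ p p′ p≡))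

  statCount : ℕ → Stat → ℕ
  statCount n t = countᵇ (λ σ → stat σ ≡ˢ t) (𝒬 n)

  -- the statistics that a gap of the given type shifts to t, if any
  unshift : Gap → Stat → Maybe Stat
  unshift descent          (d     , suc l , p)     = just (d , l , p)
  unshift inAscentPlateau  (suc d , l     , p)     = just (d , l , p)
  unshift inDescentPlateau (suc d , suc l , p)     = just (d , l , suc p)
  unshift beforePlateau    (suc d , l     , suc p) = just (d , l , p)
  unshift ascent           (suc d , suc l , p)     = just (d , l , p)
  unshift _                _                       = nothing

  shiftsToᵇ : Gap → Stat → Stat → Bool
  shiftsToᵇ g s t = maybe (s ≡ˢ_) false (unshift g t)

  Shifted⇒≡ˢ : ∀ g s s′ t → Shifted g s s′ → (s′ ≡ˢ t) ≡ shiftsToᵇ g s t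
  Shifted⇒≡ˢ descent          (d , l , p) _ (i     , zero  , k)     (refl , refl , refl) = ∧-zeroʳ (d ≡ᵇ i)
  Shifted⇒≡ˢ descent          (d , l , p) _ (i     , suc j , k)     (refl , refl , refl) = refl
  Shifted⇒≡ˢ inAscentPlateau  (d , l , p) _ (zero  , j     , k)     (refl , refl , refl) = refl
  Shifted⇒≡ˢ inAscentPlateau  (d , l , p) _ (suc i , j     , k)     (refl , refl , refl) = refl
  Shifted⇒≡ˢ inDescentPlateau (d , l , p) _ (zero  , j     , k)     (refl , refl , refl) = refl
  Shifted⇒≡ˢ inDescentPlateau (d , l , p) _ (suc i , zero  , k)     (refl , refl , refl) = ∧-zeroʳ (d ≡ᵇ i)
  Shifted⇒≡ˢ inDescentPlateau (d , l , p) _ (suc i , suc j , k)     (refl , refl , refl) = refl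
  Shifted⇒≡ˢ beforePlateau    (d , l , p) _ (zero  , j     , k)     (refl , refl , refl) = refl
  Shifted⇒≡ˢ beforePlateau    (d , l , p) _ (suc i , j     , zero)  (refl , refl , refl) =
    trans (cong ((d ≡ᵇ i) ∧_) (∧-zeroʳ (l ≡ᵇ j))) (∧-zeroʳ (d ≡ᵇ i))
  Shifted⇒≡ˢ beforePlateau    (d , l , p) _ (suc i , j     , suc k) (refl , refl , refl) = refl
  Shifted⇒≡ˢ ascent           (d , l , p) _ (zero  , j     , k)     (refl , refl , refl) = refl
  Shifted⇒≡ˢ ascent           (d , l , p) _ (suc i , zero  , k)     (refl , refl , refl) = ∧-zeroʳ (d ≡ᵇ i)
  Shifted⇒≡ˢ ascent           (d , l , p) _ (suc i , suc j , k)     (refl , refl , refl) = refl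

  countᵇ-Shifted : ∀ (f : List ℕ → Stat) s t {Xs gs} → Pointwise (λ X g → Shifted g s (f X)) Xs gs →
                   countᵇ (λ X → f X ≡ˢ t) Xs ≡ sum (map (λ g → boolToℕ (shiftsToᵇ g s t)) gs)
  countᵇ-Shifted f s t []                    = refl
  countᵇ-Shifted f s t {X ∷ Xs} {g ∷ gs} (r ∷ rs) =
    trans (countᵇ-∷ (λ X → f X ≡ˢ t) X Xs)
          (cong₂ _+_ (cong boolToℕ (Shifted⇒≡ˢ g s (f X) t r)) (countᵇ-Shifted f s t rs))

  NoTripleRepeat-count : ∀ L → (∀ x → count x L ≤ 2) → NoTripleRepeat L
  NoTripleRepeat-count []              _     = tt
  NoTripleRepeat-count (a ∷ [])        _     = tt
  NoTripleRepeat-count (a ∷ b ∷ [])    _     = tt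
  NoTripleRepeat-count (a ∷ b ∷ c ∷ l) atMost2 =
    triple-absurd ,
    NoTripleRepeat-count (b ∷ c ∷ l) (λ x → ≤-trans (m≤n+m _ (if x ≡ᵇ a then 1 else 0)) (atMost2 x))
    where
    triple-absurd : ¬ (a ≡ b × b ≡ c)
    triple-absurd (refl , refl) with atMost2 a
    ... | bound rewrite ≡ᵇ-refl a = <⇒≱ (s≤s (s≤s (s≤s z≤n))) (≤-trans (m≤m+n 3 (count a l)) bound)

  module _ {n τ} (s : Stirling n τ) where

    positive : All (1 ≤_) τ
    positive = All.map proj₁ (bounded s)

    pad-bounded : All (_< suc n) (pad τ)
    pad-bounded = s≤s z≤n ∷ All.++⁺ (All.map (s≤s ∘ proj₂) (bounded s)) (s≤s z≤n ∷ [])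

    count-pad≤2 : ∀ x → count x (pad τ) ≤ 2
    count-pad≤2 x rewrite count-++ x τ (0 ∷ []) with x
    ... | zero  rewrite count-∉ 0 τ (λ 0∈τ → <⇒≱ (All.lookup positive 0∈τ) z≤n) = ≤-refl
    ... | suc k rewrite +-identityʳ (count (suc k) τ) with k <? n
    ...   | yes k<n = ≤-reflexive (twice s k k<n)
    ...   | no  k≮n = ≤-trans (≤-reflexive (count-∉ (suc k) τ (λ p → k≮n (proj₂ (All.lookup (bounded s) p)))))
                              z≤n

  0∷pad-NoTripleRepeat : ∀ {n τ} → 1 ≤ n → Stirling n τ → NoTripleRepeat (0 ∷ pad τ)
  0∷pad-NoTripleRepeat {τ = x ∷ _} _ s =
    (λ { (_ , refl) → <⇒≱ (All.head (positive s)) z≤n }) , NoTripleRepeat-count _ (count-pad≤2 s)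
  0∷pad-NoTripleRepeat {n} {τ = []} 1≤n s = ⊥-elim (<⇒≢ (≤-trans 1≤n (m≤n*m n 2)) (length≡ s))

  -- An extra leading 0 changes none of the statistics of a padded word, and it gives the
  -- first gap a predecessor, so that gapTypes classifies every gap by the same rule.
  wordStat-0∷pad : ∀ σ → wordStat (0 ∷ pad σ) ≡ wordStat (pad σ)
  wordStat-0∷pad []      = refl
  wordStat-0∷pad (_ ∷ _) = refl

  multiplicity : ℕ → Gap → Stat → ℕ
  multiplicity n descent          (d , l , p) = d
  multiplicity n inAscentPlateau  (d , l , p) = l
  multiplicity n inDescentPlateau (d , l , p) = p
  multiplicity n beforePlateau    (d , l , p) = l
  multiplicity n ascent           (d , l , p) = suc (2 * n) ∸ (d + l + p + l)

  occurrences-gapTypes-pad : ∀ {n τ} → 1 ≤ n → Stirling n τ →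
                             ∀ g → occurrences g (gapTypes 0 (pad τ)) ≡ multiplicity n g (stat τ)
  occurrences-gapTypes-pad {n} {τ} 1≤n s = by-type
    where
    gs : List Gap
    gs = gapTypes 0 (pad τ)
    o : Gap → ℕ
    o g = occurrences g gs
    ascentPlateaus-0∷pad : ascentPlateaus (0 ∷ pad τ) ≡ ascentPlateaus (pad τ)
    ascentPlateaus-0∷pad = cong (proj₁ ∘ proj₂) (wordStat-0∷pad τ)
    descentPlateaus-0∷pad : descentPlateaus (0 ∷ pad τ) ≡ descentPlateaus (pad τ)
    descentPlateaus-0∷pad = cong (proj₂ ∘ proj₂) (wordStat-0∷pad τ)
    oD : o descent ≡ des τ
    oD = trans (occurrences-descent 0 (pad τ)) (sym (des≡descents-pad τ))
    oAP : o inAscentPlateau ≡ laplat τ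
    oAP = trans (occurrences-inAscentPlateau 0 (pad τ))
                (trans ascentPlateaus-0∷pad (sym (countRange-plateaus _<ᵇ_ τ (positive s))))
    oDP : o inDescentPlateau ≡ desp τ
    oDP = trans (occurrences-inDescentPlateau 0 (pad τ) (0∷pad-NoTripleRepeat 1≤n s))
                (trans descentPlateaus-0∷pad (sym (countRange-plateaus (λ a b → b <ᵇ a) τ (positive s))))
    oBP : o beforePlateau ≡ laplat τ
    oBP = trans (occurrences-beforePlateau 0 (pad τ)) (sym (countRange-plateaus _<ᵇ_ τ (positive s)))
    others : ℕ
    others = o descent + o inAscentPlateau + o inDescentPlateau + o beforePlateau
    total : others + o ascent ≡ suc (2 * n)
    total = begin
      others + o ascent
        ≡⟨ reassociate (o descent) (o inAscentPlateau) (o inDescentPlateau) (o beforePlateau) (o ascent) ⟩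
      sum (map o allGaps)       ≡⟨ length≡sum-occurrences gs ⟨
      length gs                 ≡⟨ length-gapTypes 0 (pad τ) ⟩
      length (pad τ) ∸ 1        ≡⟨ cong (_∸ 1) (length-pad τ) ⟩
      suc (length τ)            ≡⟨ cong suc (length≡ s) ⟩
      suc (2 * n)               ∎
      where
      open ≡-Reasoning
      reassociate : ∀ a b c d e → a + b + c + d + e ≡ a + (b + (c + (d + (e + 0))))
      reassociate = solve-∀
    by-type : ∀ g → o g ≡ multiplicity n g (stat τ)
    by-type descent          = oD
    by-type inAscentPlateau  = oAP
    by-type inDescentPlateau = oDP
    by-type beforePlateau    = oBP
    by-type ascent           = begin
      o ascent                                   ≡⟨ m+n∸m≡n others (o ascent) ⟨
      others + o ascent ∸ others                 ≡⟨ cong₂ _∸_ total (cong₂ _+_ (cong₂ _+_ (cong₂ _+_ oD oAP) oDP) oBP) ⟩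
      suc (2 * n) ∸ (des τ + laplat τ + desp τ + laplat τ) ∎
      where open ≡-Reasoning

  countᵇ-insertions : ∀ {n τ} → 1 ≤ n → Stirling n τ → ∀ t →
    countᵇ (λ σ → stat σ ≡ˢ t) (insertions (suc n) τ)
    ≡ sum (map (λ g → multiplicity n g (stat τ) * boolToℕ (shiftsToᵇ g (stat τ) t)) allGaps)
  countᵇ-insertions {n} {τ} 1≤n s t = begin
    countᵇ (λ σ → stat σ ≡ˢ t) (insertions m τ)
      ≡⟨ countᵇ-cong-∈ _ _ (insertions m τ) (λ {σ} σ∈ → cong (_≡ˢ t) (stat≡wordStat-0∷pad σ∈)) ⟩
    countᵇ (λ σ → wordStat (0 ∷ pad σ) ≡ˢ t) (insertions m τ)
      ≡⟨ countᵇ-map (λ X → wordStat (0 ∷ X) ≡ˢ t) pad (insertions m τ) ⟨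
    countᵇ (λ X → wordStat (0 ∷ X) ≡ˢ t) (map pad (insertions m τ))
      ≡⟨ cong (countᵇ (λ X → wordStat (0 ∷ X) ≡ˢ t)) (map-pad-insertions m 0 τ) ⟩
    countᵇ (λ X → wordStat (0 ∷ X) ≡ˢ t) (padInsertions m (pad τ))
      ≡⟨ countᵇ-Shifted (wordStat ∘ (0 ∷_)) W t
           (gaps-shift 0 (pad τ) (0∷pad-NoTripleRepeat 1≤n s) (pad-bounded s)) ⟩
    sum (map (λ g → boolToℕ (shiftsToᵇ g W t)) gs)
      ≡⟨ sum-map-by-type (λ g → boolToℕ (shiftsToᵇ g W t)) gs ⟩
    sum (map (λ g → occurrences g gs * boolToℕ (shiftsToᵇ g W t)) allGaps)
      ≡⟨ sum-map-cong-∈ _ _ allGaps (λ {g} _ →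
           cong₂ (λ k s′ → k * boolToℕ (shiftsToᵇ g s′ t)) (occurrences-gapTypes-pad 1≤n s g) W≡stat) ⟩
    sum (map (λ g → multiplicity n g (stat τ) * boolToℕ (shiftsToᵇ g (stat τ) t)) allGaps) ∎
    where
    open ≡-Reasoning
    m : ℕ
    m = suc n
    W : Stat
    W = wordStat (0 ∷ pad τ)
    gs : List Gap
    gs = gapTypes 0 (pad τ)
    W≡stat : W ≡ stat τ
    W≡stat = trans (wordStat-0∷pad τ) (sym (stat≡wordStat-pad τ (positive s)))
    stat≡wordStat-0∷pad : ∀ {σ} → σ ∈ insertions m τ → stat σ ≡ wordStat (0 ∷ pad σ)
    stat≡wordStat-0∷pad {σ} σ∈ =
      trans (stat≡wordStat-pad σ (positive (insert-Stirling s σ∈))) (sym (wordStat-0∷pad σ))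

  sum-map-*-≡ˢ : ∀ (f : Stat → ℕ) s (σs : List (List ℕ)) →
    sum (map (λ σ → f (stat σ) * boolToℕ (stat σ ≡ˢ s)) σs) ≡ f s * countᵇ (λ σ → stat σ ≡ˢ s) σs
  sum-map-*-≡ˢ f s []       = sym (*-zeroʳ (f s))
  sum-map-*-≡ˢ f s (σ ∷ σs)
    rewrite countᵇ-∷ (λ σ → stat σ ≡ˢ s) σ σs | sum-map-*-≡ˢ f s σs with stat σ ≡ˢ s in eq
  ... | false = cong (_+ f s * countᵇ (λ σ → stat σ ≡ˢ s) σs) (*-zeroʳ (f (stat σ)))
  ... | true rewrite ≡ˢ⇒≡ (stat σ) s (subst T (sym eq) tt) =
    trans (cong (_+ f s * countᵇ (λ σ → stat σ ≡ˢ s) σs) (*-identityʳ (f s))) (sym (*-suc (f s) _))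

  sum-map-*-maybe : ∀ n (f : Stat → ℕ) (u : Maybe Stat) →
    sum (map (λ σ → f (stat σ) * boolToℕ (maybe (stat σ ≡ˢ_) false u)) (𝒬 n)) ≡ maybe (λ s → f s * statCount n s) 0 u
  sum-map-*-maybe n f (just s) = sum-map-*-≡ˢ f s (𝒬 n)
  sum-map-*-maybe n f nothing  = sum-map-zero _ (𝒬 n) (λ σ → *-zeroʳ (f (stat σ)))

  recurrenceTerm : ℕ → Gap → Stat → ℕ
  recurrenceTerm n g t = maybe (λ s → multiplicity n g s * statCount n s) 0 (unshift g t)

  statCount-suc : ∀ {n} → 1 ≤ n → ∀ t → statCount (suc n) t ≡ sum (map (λ g → recurrenceTerm n g t) allGaps)
  statCount-suc {n} 1≤n t = begin
    statCount (suc n) t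
      ≡⟨ countᵇ-𝒬-suc n (λ σ → stat σ ≡ˢ t) ⟩
    sum (map (λ τ → countᵇ (λ σ → stat σ ≡ˢ t) (insertions (suc n) τ)) (𝒬 n))
      ≡⟨ sum-map-cong-∈ _ _ (𝒬 n) (λ τ∈ → countᵇ-insertions 1≤n (∈𝒬⇒Stirling τ∈) t) ⟩
    sum (map (λ τ → sum (map (contribution τ) allGaps)) (𝒬 n))
      ≡⟨ sum-map-swap contribution (𝒬 n) allGaps ⟩
    sum (map (λ g → sum (map (λ τ → contribution τ g) (𝒬 n))) allGaps)
      ≡⟨ sum-map-cong-∈ _ _ allGaps (λ {g} _ → sum-map-*-maybe n (multiplicity n g) (unshift g t)) ⟩
    sum (map (λ g → recurrenceTerm n g t) allGaps) ∎
    where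
    open ≡-Reasoning
    contribution : List ℕ → Gap → ℕ
    contribution τ g = multiplicity n g (stat τ) * boolToℕ (shiftsToᵇ g (stat τ) t)

module Binomial where

  open import Data.Nat using (_+_; _*_; _∸_)
  open import Data.Nat.Properties
  open import Data.Nat.Combinatorics using (_C_; nC1≡n; nCk+nC[k+1]≡[n+1]C[k+1])
  open import Data.Nat.Tactic.RingSolver using (solve-∀)

  pascal : ∀ e k → suc e C suc k ≡ e C k + e C suc k
  pascal e k = sym (nCk+nC[k+1]≡[n+1]C[k+1] e k)

  C-absorption : ∀ e k → suc k * (suc e C suc k) ≡ suc e * (e C k)
  C-absorption e       zero    = trans (*-identityˡ _) (trans (nC1≡n (suc e)) (sym (*-identityʳ (suc e))))
  C-absorption zero    (suc k) = *-zeroʳ (suc (suc k))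
  C-absorption (suc e) (suc k) = begin
    suc (suc k) * (suc (suc e) C suc (suc k))
      ≡⟨ cong (suc (suc k) *_) (pascal (suc e) (suc k)) ⟩
    suc (suc k) * (suc e C suc k + suc e C suc (suc k))
      ≡⟨ *-distribˡ-+ (suc (suc k)) (suc e C suc k) _ ⟩
    suc (suc k) * (suc e C suc k) + suc (suc k) * (suc e C suc (suc k))
      ≡⟨ cong (suc (suc k) * (suc e C suc k) +_) (C-absorption e (suc k)) ⟩
    suc e C suc k + suc k * (suc e C suc k) + suc e * (e C suc k)
      ≡⟨ cong (λ x → suc e C suc k + x + suc e * (e C suc k)) (C-absorption e k) ⟩
    suc e C suc k + suc e * (e C k) + suc e * (e C suc k)
      ≡⟨ +-assoc (suc e C suc k) _ _ ⟩
    suc e C suc k + (suc e * (e C k) + suc e * (e C suc k))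
      ≡⟨ cong (suc e C suc k +_) (*-distribˡ-+ (suc e) (e C k) _) ⟨
    suc e C suc k + suc e * (e C k + e C suc k)
      ≡⟨ cong (λ x → suc e C suc k + suc e * x) (pascal e k) ⟨
    suc (suc e) * (suc e C suc k) ∎
    where open ≡-Reasoning

  C-absorption-∸ : ∀ e k → (suc e ∸ k) * (suc e C k) ≡ suc e * (e C k)
  C-absorption-∸ e zero    = refl
  C-absorption-∸ e (suc k) = begin
    (e ∸ k) * (suc e C suc k)                               ≡⟨ *-distribʳ-∸ (suc e C suc k) (suc e) (suc k) ⟩
    suc e * (suc e C suc k) ∸ suc k * (suc e C suc k)       ≡⟨ cong₂ _∸_ (cong (suc e *_) (pascal e k)) (C-absorption e k) ⟩
    suc e * (e C k + e C suc k) ∸ suc e * (e C k)           ≡⟨ cong (_∸ suc e * (e C k)) (*-distribˡ-+ (suc e) (e C k) _) ⟩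
    suc e * (e C k) + suc e * (e C suc k) ∸ suc e * (e C k) ≡⟨ m+n∸m≡n (suc e * (e C k)) _ ⟩
    suc e * (e C suc k)                                     ∎
    where open ≡-Reasoning

  C-pair : ∀ e k → suc k * (e C suc k) + (e ∸ k) * (e C k) ≡ 2 * e * ((e ∸ 1) C k)
  C-pair zero    k rewrite 0∸n≡0 k = trans (+-identityʳ _) (*-zeroʳ (suc k))
  C-pair (suc e) k = trans (cong₂ _+_ (C-absorption e k) (C-absorption-∸ e k)) (double (suc e) (e C k))
    where
    double : ∀ x y → x * y + x * y ≡ 2 * x * y
    double = solve-∀

-- Imported only now: with ℤ's +_ in scope, the ℕ sections (x +_) above would be ambiguous.
open import Data.Integer using (+_)
import Data.Integer.Properties as ℤ

module Factorisation where

  open StatisticsRecurrence using (statCount; recurrenceTerm; statCount-suc; beforePlateau; allGaps)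
  open Binomial using (pascal; C-pair)
  open import Data.Nat.Combinatorics using (_C_)
  open import Data.Integer using (ℤ; -_; _+_; _*_)
  open import Data.Integer.Tactic.RingSolver using (solve-∀)
  import Data.Nat.Tactic.RingSolver as ℕSolver
  import Data.Nat as ℕ
  import Data.Nat.Properties as ℕ

  mulX-∂x : ∀ (g : Poly) a b → mulX (∂x g) a b ≡ + a * g a b
  mulX-∂x g zero    b = refl
  mulX-∂x g (suc a) b = refl

  mulY-∂y : ∀ (g : Poly) a b → mulY (∂y g) a b ≡ + b * g a b
  mulY-∂y g a zero    = refl
  mulY-∂y g a (suc b) = refl

  module _ (n : ℕ) where

    private
      N : ℕ
      N = suc n
      c : ℤ
      c = + (4 ℕ.* N ℕ.+ 2)

    γ-zeroˡ : ∀ l → γ (suc N) 0 l ≡ + 0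
    γ-zeroˡ l = cong (_+ (+ 0 + + 0)) (ℤ.*-zeroʳ c)

    γ-zeroʳ : ∀ d → γ (suc N) d 0 ≡ + 0
    γ-zeroʳ zero    = γ-zeroˡ 0
    γ-zeroʳ (suc d) = cong (_+ (+ 0 + + 0)) (ℤ.*-zeroʳ c)

    γ-suc-suc : ∀ a b → γ (suc N) (suc a) (suc b) ≡
      + suc a * γ N (suc a) b + + suc b * γ N a (suc b) + (c + - + 2 * + a + - + 4 * + b) * γ N a b
    γ-suc-suc a b = begin
      γ (suc N) (suc a) (suc b)
        ≡⟨ cong₂ (λ u v → c * γ N a b + ((+ suc a * γ N (suc a) b + - + 2 * u)
                                         + (+ suc b * γ N a (suc b) + - + 4 * v)))
                 (mulX-∂x (γ N) a b) (mulY-∂y (γ N) a b) ⟩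
      c * γ N a b + ((+ suc a * γ N (suc a) b + - + 2 * (+ a * γ N a b))
                     + (+ suc b * γ N a (suc b) + - + 4 * (+ b * γ N a b)))
        ≡⟨ collect c (+ a) (+ b) (+ suc a) (+ suc b) (γ N a b) (γ N (suc a) b) (γ N a (suc b)) ⟩
      + suc a * γ N (suc a) b + + suc b * γ N a (suc b) + (c + - + 2 * + a + - + 4 * + b) * γ N a b ∎
      where
      open ≡-Reasoning
      collect : ∀ c a b a′ b′ g g₁ g₂ → c * g + ((a′ * g₁ + - + 2 * (a * g)) + (b′ * g₂ + - + 4 * (b * g)))
                                        ≡ a′ * g₁ + b′ * g₂ + (c + - + 2 * a + - + 4 * b) * g
      collect = solve-∀

  -- For statistics (d , l , p) in order N, excess N d l counts the plain ascent gaps together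
  -- with the p descent-plateaus.
  excess : ℕ → ℕ → ℕ → ℕ
  excess N d l = suc (2 ℕ.* N) ℕ.∸ (d ℕ.+ l ℕ.+ l)

  module _ (N a b : ℕ) where

    private
      twice-suc : 2 ℕ.* suc N ≡ suc (suc (2 ℕ.* N))
      twice-suc = ℕ.*-suc 2 N
      shift-b : a ℕ.+ suc b ℕ.+ suc b ≡ suc (suc (a ℕ.+ b ℕ.+ b))
      shift-b = trans (cong (ℕ._+ suc b) (ℕ.+-suc a b)) (cong suc (ℕ.+-suc (a ℕ.+ b) b))

    outside-suc : suc (2 ℕ.* suc N) ℕ.< suc a ℕ.+ suc b ℕ.+ suc b → 2 ℕ.* N ℕ.< a ℕ.+ b ℕ.+ b
    outside-suc outside rewrite twice-suc | shift-b = ℕ.≤-pred (ℕ.≤-pred (ℕ.≤-pred outside))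

    outside-suc-b : 2 ℕ.* N ℕ.< a ℕ.+ b ℕ.+ b → suc (2 ℕ.* N) ℕ.< a ℕ.+ suc b ℕ.+ suc b
    outside-suc-b outside rewrite shift-b = s≤s (ℕ.m≤n⇒m≤1+n outside)

    excess-suc : excess (suc N) (suc a) (suc b) ≡ excess N (suc a) b
    excess-suc rewrite twice-suc | shift-b = refl

    excess-suc-∸ : excess (suc N) (suc a) (suc b) ≡ excess N a b ℕ.∸ 1
    excess-suc-∸ rewrite twice-suc | shift-b
                       | ℕ.∸-+-assoc (suc (2 ℕ.* N)) (a ℕ.+ b ℕ.+ b) 1 | ℕ.+-comm (a ℕ.+ b ℕ.+ b) 1 = refl

    excess-suc-≤ : a ℕ.+ suc b ℕ.+ suc b ℕ.≤ suc (2 ℕ.* N) → excess (suc N) (suc a) (suc b) ≡ suc (excess N a (suc b))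
    excess-suc-≤ le rewrite twice-suc = ℕ.+-∸-assoc 1 le

    multiplicity-ascent : ∀ k → suc (2 ℕ.* N) ℕ.∸ (a ℕ.+ b ℕ.+ k ℕ.+ b) ≡ excess N a b ℕ.∸ k
    multiplicity-ascent k rewrite ℕ.∸-+-assoc (suc (2 ℕ.* N)) (a ℕ.+ b ℕ.+ b) k
                                | ℕ.+-assoc (a ℕ.+ b) k b | ℕ.+-comm k b | ℕ.+-assoc (a ℕ.+ b) b k = refl

    coefficient : a ℕ.+ b ℕ.+ b ℕ.≤ suc (2 ℕ.* N) → + (4 ℕ.* N ℕ.+ 2) + - + 2 * + a + - + 4 * + b ≡ + (2 ℕ.* excess N a b)
    coefficient le = begin
      + (4 ℕ.* N ℕ.+ 2) + - + 2 * + a + - + 4 * + b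
        ≡⟨ cong (λ x → + x + - + 2 * + a + - + 4 * + b) 4N+2≡ ⟩
      + (2 ℕ.* e ℕ.+ 2 ℕ.* a ℕ.+ 4 ℕ.* b) + - + 2 * + a + - + 4 * + b
        ≡⟨ cong (λ x → x + - + 2 * + a + - + 4 * + b)
                (trans (ℤ.pos-+ (2 ℕ.* e ℕ.+ 2 ℕ.* a) (4 ℕ.* b))
                       (cong₂ _+_ (trans (ℤ.pos-+ (2 ℕ.* e) (2 ℕ.* a)) (cong (λ x → + (2 ℕ.* e) + x) (ℤ.pos-* 2 a)))
                                  (ℤ.pos-* 4 b))) ⟩
      + (2 ℕ.* e) + + 2 * + a + + 4 * + b + - + 2 * + a + - + 4 * + b
        ≡⟨ cancel (+ (2 ℕ.* e)) (+ a) (+ b) ⟩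
      + (2 ℕ.* e) ∎
      where
      open ≡-Reasoning
      e : ℕ
      e = excess N a b
      4N+2≡ : 4 ℕ.* N ℕ.+ 2 ≡ 2 ℕ.* e ℕ.+ 2 ℕ.* a ℕ.+ 4 ℕ.* b
      4N+2≡ = trans (double N) (trans (cong (2 ℕ.*_) (sym (ℕ.m∸n+n≡m le))) (expand e a b))
        where
        double : ∀ N → 4 ℕ.* N ℕ.+ 2 ≡ 2 ℕ.* suc (2 ℕ.* N)
        double = ℕSolver.solve-∀
        expand : ∀ e a b → 2 ℕ.* (e ℕ.+ (a ℕ.+ b ℕ.+ b)) ≡ 2 ℕ.* e ℕ.+ 2 ℕ.* a ℕ.+ 4 ℕ.* b
        expand = ℕSolver.solve-∀
      cancel : ∀ x a b → x + + 2 * a + + 4 * b + - + 2 * a + - + 4 * b ≡ x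
      cancel = solve-∀

  Supported : ℕ → Set
  Supported N = ∀ d l → suc (2 ℕ.* N) ℕ.< d ℕ.+ l ℕ.+ l → γ N d l ≡ + 0

  supported-1 : Supported 1
  supported-1 zero             l                _ = refl
  supported-1 (suc zero)       zero             _ = refl
  supported-1 (suc zero)       (suc zero)       (s≤s (s≤s (s≤s ())))
  supported-1 (suc zero)       (suc (suc l))    _ = refl
  supported-1 (suc (suc d))    zero             _ = refl
  supported-1 (suc (suc d))    (suc zero)       _ = refl
  supported-1 (suc (suc d))    (suc (suc l))    _ = refl

  supported-suc : ∀ n → Supported (suc n) → Supported (suc (suc n))
  supported-suc n supp zero    l       _       = γ-zeroˡ n l
  supported-suc n supp (suc a) zero    _       = γ-zeroʳ n (suc a)
  supported-suc n supp (suc a) (suc b) outside = begin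
    γ (suc N) (suc a) (suc b)
      ≡⟨ γ-suc-suc n a b ⟩
    + suc a * γ N (suc a) b + + suc b * γ N a (suc b) + coeff * γ N a b
      ≡⟨ cong₂ (λ u v → + suc a * u + + suc b * v + coeff * γ N a b)
               (supp (suc a) b (s≤s 2N<a+2b)) (supp a (suc b) (outside-suc-b N a b 2N<a+2b)) ⟩
    + suc a * + 0 + + suc b * + 0 + coeff * γ N a b
      ≡⟨ drop-zeros (+ suc a) (+ suc b) (coeff * γ N a b) ⟩
    coeff * γ N a b
      ≡⟨ coeff*γ≡0 ⟩
    + 0 ∎
    where
    open ≡-Reasoning
    N : ℕ
    N = suc n
    coeff : ℤ
    coeff = + (4 ℕ.* N ℕ.+ 2) + - + 2 * + a + - + 4 * + b
    2N<a+2b : 2 ℕ.* N ℕ.< a ℕ.+ b ℕ.+ b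
    2N<a+2b = outside-suc N a b outside
    drop-zeros : ∀ x y z → x * + 0 + y * + 0 + z ≡ z
    drop-zeros = solve-∀
    -- either γ N a b already vanishes, or a + 2b = 2N + 1 and the coefficient vanishes
    coeff*γ≡0 : coeff * γ N a b ≡ + 0
    coeff*γ≡0 with a ℕ.+ b ℕ.+ b ℕ.≤? suc (2 ℕ.* N)
    ... | yes le  = trans (cong (_* γ N a b) (trans (coefficient N a b le)
                                                    (cong (λ e → + (2 ℕ.* e)) (ℕ.m≤n⇒m∸n≡0 2N<a+2b))))
                          (ℤ.*-zeroˡ (γ N a b))
    ... | no  nle = trans (cong (coeff *_) (supp a b (ℕ.≰⇒> nle))) (ℤ.*-zeroʳ coeff)

  Factorises : ℕ → Set
  Factorises N = ∀ d l p → + statCount N (d , l , p) ≡ γ N d l * + (excess N d l C p)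

  factorises-1 : Factorises 1
  factorises-1 zero          l             p       = refl
  factorises-1 (suc zero)    zero          p       = refl
  factorises-1 (suc zero)    (suc zero)    zero    = refl
  factorises-1 (suc zero)    (suc zero)    (suc p) = refl
  factorises-1 (suc zero)    (suc (suc l)) p       = refl
  factorises-1 (suc (suc d)) zero          p       = refl
  factorises-1 (suc (suc d)) (suc zero)    p       = refl
  factorises-1 (suc (suc d)) (suc (suc l)) p       = refl

  pos-linear : ∀ m x m′ y → + (m ℕ.* x ℕ.+ m′ ℕ.* y) ≡ + m * + x + + m′ * + y
  pos-linear m x m′ y = trans (ℤ.pos-+ (m ℕ.* x) (m′ ℕ.* y)) (cong₂ _+_ (ℤ.pos-* m x) (ℤ.pos-* m′ y))

  module FactorisationStep (n : ℕ) (fac : Factorises (suc n)) (supp : Supported (suc n)) (a b : ℕ) where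

    N : ℕ
    N = suc n
    γ₀ γ₁ γ₂ : ℤ
    γ₀ = γ N a b
    γ₁ = γ N (suc a) b
    γ₂ = γ N a (suc b)
    coeff : ℤ
    coeff = + (4 ℕ.* N ℕ.+ 2) + - + 2 * + a + - + 4 * + b
    e₂ e₃ : ℕ
    e₂ = excess N a (suc b)
    e₃ = excess N a b

    B : ℕ → ℤ
    B k = + (excess (suc N) (suc a) (suc b) C k)

    descent-term : ∀ k → + (suc a ℕ.* statCount N (suc a , b , k)) ≡ + suc a * γ₁ * B k
    descent-term k = begin
      + (suc a ℕ.* statCount N (suc a , b , k))      ≡⟨ ℤ.pos-* (suc a) _ ⟩
      + suc a * + statCount N (suc a , b , k)        ≡⟨ cong (+ suc a *_) (fac (suc a) b k) ⟩
      + suc a * (γ₁ * + (excess N (suc a) b C k))    ≡⟨ ℤ.*-assoc (+ suc a) γ₁ _ ⟨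
      + suc a * γ₁ * + (excess N (suc a) b C k)      ≡⟨ cong (λ e → + suc a * γ₁ * + (e C k)) (excess-suc N a b) ⟨
      + suc a * γ₁ * B k                             ∎
      where open ≡-Reasoning

    scaled-γ₂ : ∀ k → + suc b * γ₂ * + (suc e₂ C k) ≡ + suc b * γ₂ * B k
    scaled-γ₂ k with a ℕ.+ suc b ℕ.+ suc b ℕ.≤? suc (2 ℕ.* N)
    ... | yes le  = cong (λ e → + suc b * γ₂ * + (e C k)) (sym (excess-suc-≤ N a b le))
    ... | no  nle rewrite supp a (suc b) (ℕ.≰⇒> nle) =
      trans (vanish (+ suc b) (+ (suc e₂ C k))) (sym (vanish (+ suc b) (B k)))
      where
      vanish : ∀ x y → x * + 0 * y ≡ + 0
      vanish = solve-∀

    ascentPlateau-terms : ∀ k →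
      + (suc b ℕ.* statCount N (a , suc b , k) ℕ.+ recurrenceTerm N beforePlateau (suc a , suc b , k))
      ≡ + suc b * γ₂ * B k
    ascentPlateau-terms zero = begin
      + (suc b ℕ.* statCount N (a , suc b , 0) ℕ.+ 0)  ≡⟨ cong +_ (ℕ.+-identityʳ _) ⟩
      + (suc b ℕ.* statCount N (a , suc b , 0))        ≡⟨ ℤ.pos-* (suc b) _ ⟩
      + suc b * + statCount N (a , suc b , 0)          ≡⟨ cong (+ suc b *_) (fac a (suc b) 0) ⟩
      + suc b * (γ₂ * + 1)                             ≡⟨ ℤ.*-assoc (+ suc b) γ₂ _ ⟨
      + suc b * γ₂ * B 0                               ∎
      where open ≡-Reasoning
    ascentPlateau-terms (suc k) = begin
      + (suc b ℕ.* statCount N (a , suc b , suc k) ℕ.+ suc b ℕ.* statCount N (a , suc b , k))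
        ≡⟨ pos-linear (suc b) (statCount N (a , suc b , suc k)) (suc b) (statCount N (a , suc b , k)) ⟩
      + suc b * + statCount N (a , suc b , suc k) + + suc b * + statCount N (a , suc b , k)
        ≡⟨ cong₂ (λ u v → + suc b * u + + suc b * v) (fac a (suc b) (suc k)) (fac a (suc b) k) ⟩
      + suc b * (γ₂ * + (e₂ C suc k)) + + suc b * (γ₂ * + (e₂ C k))
        ≡⟨ factor (+ suc b) γ₂ (+ (e₂ C suc k)) (+ (e₂ C k)) ⟩
      + suc b * γ₂ * (+ (e₂ C k) + + (e₂ C suc k))
        ≡⟨ cong (λ x → + suc b * γ₂ * x) (trans (sym (ℤ.pos-+ (e₂ C k) _)) (cong +_ (sym (pascal e₂ k)))) ⟩
      + suc b * γ₂ * + (suc e₂ C suc k)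
        ≡⟨ scaled-γ₂ (suc k) ⟩
      + suc b * γ₂ * B (suc k) ∎
      where
      open ≡-Reasoning
      factor : ∀ x g u v → x * (g * u) + x * (g * v) ≡ x * g * (v + u)
      factor = solve-∀

    scaled-γ₀ : ∀ k → γ₀ * + (2 ℕ.* e₃ ℕ.* ((e₃ ℕ.∸ 1) C k)) ≡ coeff * γ₀ * B k
    scaled-γ₀ k with a ℕ.+ b ℕ.+ b ℕ.≤? suc (2 ℕ.* N)
    ... | yes le  rewrite coefficient N a b le | excess-suc-∸ N a b =
      trans (cong (γ₀ *_) (ℤ.pos-* (2 ℕ.* e₃) _)) (swap γ₀ (+ (2 ℕ.* e₃)) (+ ((e₃ ℕ.∸ 1) C k)))
      where
      swap : ∀ g x y → g * (x * y) ≡ x * g * y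
      swap = solve-∀
    ... | no  nle rewrite supp a b (ℕ.≰⇒> nle) = sym (vanish coeff (B k))
      where
      vanish : ∀ x y → x * + 0 * y ≡ + 0
      vanish = solve-∀

    descentPlateau-ascent-terms : ∀ k →
      + (suc k ℕ.* statCount N (a , b , suc k) ℕ.+ (suc (2 ℕ.* N) ℕ.∸ (a ℕ.+ b ℕ.+ k ℕ.+ b)) ℕ.* statCount N (a , b , k))
      ≡ coeff * γ₀ * B k
    descentPlateau-ascent-terms k = begin
      + (suc k ℕ.* statCount N (a , b , suc k) ℕ.+ (suc (2 ℕ.* N) ℕ.∸ (a ℕ.+ b ℕ.+ k ℕ.+ b)) ℕ.* statCount N (a , b , k))
        ≡⟨ cong (λ m → + (suc k ℕ.* statCount N (a , b , suc k) ℕ.+ m ℕ.* statCount N (a , b , k)))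
                (multiplicity-ascent N a b k) ⟩
      + (suc k ℕ.* statCount N (a , b , suc k) ℕ.+ (e₃ ℕ.∸ k) ℕ.* statCount N (a , b , k))
        ≡⟨ pos-linear (suc k) (statCount N (a , b , suc k)) (e₃ ℕ.∸ k) (statCount N (a , b , k)) ⟩
      + suc k * + statCount N (a , b , suc k) + + (e₃ ℕ.∸ k) * + statCount N (a , b , k)
        ≡⟨ cong₂ (λ u v → + suc k * u + + (e₃ ℕ.∸ k) * v) (fac a b (suc k)) (fac a b k) ⟩
      + suc k * (γ₀ * + (e₃ C suc k)) + + (e₃ ℕ.∸ k) * (γ₀ * + (e₃ C k))
        ≡⟨ factor γ₀ (+ suc k) (+ (e₃ C suc k)) (+ (e₃ ℕ.∸ k)) (+ (e₃ C k)) ⟩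
      γ₀ * (+ suc k * + (e₃ C suc k) + + (e₃ ℕ.∸ k) * + (e₃ C k))
        ≡⟨ cong (γ₀ *_) (pos-linear (suc k) (e₃ C suc k) (e₃ ℕ.∸ k) (e₃ C k)) ⟨
      γ₀ * + (suc k ℕ.* (e₃ C suc k) ℕ.+ (e₃ ℕ.∸ k) ℕ.* (e₃ C k))
        ≡⟨ cong (λ x → γ₀ * + x) (C-pair e₃ k) ⟩
      γ₀ * + (2 ℕ.* e₃ ℕ.* ((e₃ ℕ.∸ 1) C k))
        ≡⟨ scaled-γ₀ k ⟩
      coeff * γ₀ * B k ∎
      where
      open ≡-Reasoning
      factor : ∀ g x u y v → x * (g * u) + y * (g * v) ≡ g * (x * u + y * v)
      factor = solve-∀

  no-gaps : ∀ n d l p → sum (map (λ g → recurrenceTerm (suc n) g (d , l , p)) allGaps) ≡ 0 → γ (suc (suc n)) d l ≡ + 0 →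
            + statCount (suc (suc n)) (d , l , p) ≡ γ (suc (suc n)) d l * + (excess (suc (suc n)) d l C p)
  no-gaps n d l p none γ≡0 =
    trans (cong +_ (trans (statCount-suc {suc n} (s≤s z≤n) (d , l , p)) none))
          (sym (trans (cong (_* + (excess (suc (suc n)) d l C p)) γ≡0) (ℤ.*-zeroˡ (+ (excess (suc (suc n)) d l C p)))))

  factorises-suc : ∀ n → Factorises (suc n) → Supported (suc n) → Factorises (suc (suc n))
  factorises-suc n fac supp zero    zero    p       = no-gaps n 0 0 p refl (γ-zeroˡ n 0)
  factorises-suc n fac supp zero    (suc l) p       = no-gaps n 0 (suc l) p refl (γ-zeroˡ n (suc l))
  factorises-suc n fac supp (suc d) zero    zero    = no-gaps n (suc d) 0 0 refl (γ-zeroʳ n (suc d))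
  factorises-suc n fac supp (suc d) zero    (suc p) = no-gaps n (suc d) 0 (suc p) refl (γ-zeroʳ n (suc d))
  factorises-suc n fac supp (suc a) (suc b) k = begin
    + statCount (suc N) (suc a , suc b , k)
      ≡⟨ cong +_ (statCount-suc {N} (s≤s z≤n) (suc a , suc b , k)) ⟩
    + (r₁ ℕ.+ (r₂ ℕ.+ (r₃ ℕ.+ (r₄ ℕ.+ (r₅ ℕ.+ 0)))))
      ≡⟨ cong +_ (regroup r₁ r₂ r₃ r₄ r₅) ⟩
    + (r₁ ℕ.+ (r₂ ℕ.+ r₄) ℕ.+ (r₃ ℕ.+ r₅))
      ≡⟨ trans (ℤ.pos-+ (r₁ ℕ.+ (r₂ ℕ.+ r₄)) (r₃ ℕ.+ r₅)) (cong (_+ + (r₃ ℕ.+ r₅)) (ℤ.pos-+ r₁ (r₂ ℕ.+ r₄))) ⟩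
    + r₁ + + (r₂ ℕ.+ r₄) + + (r₃ ℕ.+ r₅)
      ≡⟨ cong₂ _+_ (cong₂ _+_ (descent-term k) (ascentPlateau-terms k)) (descentPlateau-ascent-terms k) ⟩
    + suc a * γ₁ * B k + + suc b * γ₂ * B k + coeff * γ₀ * B k
      ≡⟨ factor (+ suc a) (+ suc b) coeff γ₁ γ₂ γ₀ (B k) ⟩
    (+ suc a * γ₁ + + suc b * γ₂ + coeff * γ₀) * B k
      ≡⟨ cong (_* B k) (γ-suc-suc n a b) ⟨
    γ (suc N) (suc a) (suc b) * B k ∎
    where
    open ≡-Reasoning
    open FactorisationStep n fac supp a b
    r₁ r₂ r₃ r₄ r₅ : ℕ
    r₁ = suc a ℕ.* statCount N (suc a , b , k)
    r₂ = suc b ℕ.* statCount N (a , suc b , k)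
    r₃ = suc k ℕ.* statCount N (a , b , suc k)
    r₄ = recurrenceTerm N beforePlateau (suc a , suc b , k)
    r₅ = (suc (2 ℕ.* N) ℕ.∸ (a ℕ.+ b ℕ.+ k ℕ.+ b)) ℕ.* statCount N (a , b , k)
    regroup : ∀ x₁ x₂ x₃ x₄ x₅ → x₁ ℕ.+ (x₂ ℕ.+ (x₃ ℕ.+ (x₄ ℕ.+ (x₅ ℕ.+ 0)))) ≡ x₁ ℕ.+ (x₂ ℕ.+ x₄) ℕ.+ (x₃ ℕ.+ x₅)
    regroup = ℕSolver.solve-∀
    factor : ∀ x y z g₁ g₂ g₀ w → x * g₁ * w + y * g₂ * w + z * g₀ * w ≡ (x * g₁ + y * g₂ + z * g₀) * w
    factor = solve-∀

  factorises : ∀ n → Factorises (suc n) × Supported (suc n)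
  factorises zero    = factorises-1 , supported-1
  factorises (suc n) = let (fac , supp) = factorises n in factorises-suc n fac supp , supported-suc n supp

-- stirCount n i j unfolds to statCount n (i , j , 0), and e C 0 reduces to 1.
theorem10 : (n i j : ℕ) → 1 ≤ n → γ n i j ≡ + stirCount n i j
theorem10 (suc n) i j _ = sym (trans (proj₁ (Factorisation.factorises n) i j 0) (ℤ.*-identityʳ (γ (suc n) i j)))
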